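{- Let $T$ be a well-totally dominated balanced tree of height 3. Then either $T\cong P_6$, or there exist $k\ge 1$ and vertices $v_1,\dots,v_k$ such that $T\cong \mathcal{O}(P_6,(v_1,\dots,v_k))$, where $v_1$ is a vertex of $P_6$ of height 1, 2 or 3, and each $v_j$ ($j\ge 2$) is a vertex of height 1, 2 or 3 in $\mathcal{O}(P_6,(v_1,\dots,v_{j-1}))$.
   Context: All graphs are finite and simple. $P_n$ is the path with vertex set $\{0,1,\dots,n\}$ and edges $\{i,i+1\}$. A leaf is a vertex of degree 1; the height of a vertex is its minimum distance to a leaf; $V_k$ is the set of vertices of height $k$ and $\mathrm{height}(T)=\max\{k: V_k\neq\emptyset\}$. A tree is balanced if no two vertices of the same height are adjacent. A total dominating set (TDS) is a set $S$ with $N(S)=V$ ($N$ = open neighborhood); a graph is well-totally dominated if all its minimal (with respect to inclusion) TDSs have the same size. For a tree $T$ and a vertex $v$ of $T$ of height 1, 2 or 3, the tree $\mathcal{O}(T,v)$ is obtained as follows (taking disjoint copies of the added paths): if $\mathrm{height}(v)=1$, add a new vertex adjacent to $v$ (a copy of $P_0$ joined by an edge to $v$); if $\mathrm{height}(v)=2$, take a new copy of $P_3$ and add the edge between $v$ and vertex $3$ of it; if $\mathrm{height}(v)=3$, take a new copy of $P_2$ and add the edge between $v$ and vertex $2$ of it. Inductively, $\mathcal{O}(T,(v_1,\dots,v_n))=\mathcal{O}(\mathcal{O}(T,(v_1,\dots,v_{n-1})),v_n)$, with heights computed in the current tree. -}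

module Defs where

open import Data.Nat using (ℕ; zero; suc; _+_; _≤_; _≡ᵇ_)
open import Data.Bool using (Bool; true; false; _∧_; _∨_)
open import Data.Fin using (Fin; toℕ; splitAt)
open import Data.Fin.Properties using () renaming (_≟_ to _≟F_)
open import Data.Fin.Subset using (Subset; _∈_; _⊂_; ∣_∣)
open import Data.Vec using (tabulate)
open import Data.List using (List; []; _∷_; _∷ʳ_; length)
open import Data.List.Relation.Unary.Linked using (Linked)
open import Data.List.Relation.Unary.Unique.Propositional using (Unique)
open import Data.Sum using (_⊎_; inj₁; inj₂)
open import Data.Product using (Σ; ∃; _×_)
open import Function.Bundles using (_↔_; Inverse)
open import Relation.Nullary using (¬_)
open import Data.Empty using (⊥)
open import Relation.Nullary.Decidable using (⌊_⌋)
open import Relation.Binary.PropositionalEquality using (_≡_)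

record Graph : Set where
  constructor graph
  field
    size : ℕ
    adj  : Fin size → Fin size → Bool
open Graph public

Adj : (G : Graph) → Fin (size G) → Fin (size G) → Set
Adj G u v = adj G u v ≡ true

IsSimple : Graph → Set
IsSimple G = (∀ u v → adj G u v ≡ adj G v u) × (∀ u → adj G u u ≡ false)

data Walk (G : Graph) : Fin (size G) → Fin (size G) → ℕ → Set where
  nil  : ∀ u → Walk G u u 0
  cons : ∀ {u w v k} → Adj G u w → Walk G w v k → Walk G u v (suc k)

Connected : Graph → Set
Connected G = ∀ u v → ∃ λ k → Walk G u v k

HasCycle : Graph → Set
HasCycle G = Σ (Fin (size G)) λ x → Σ (List (Fin (size G))) λ xs →
  (2 ≤ length xs) × Unique (x ∷ xs) × Linked (Adj G) ((x ∷ xs) ∷ʳ x)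

IsTree : Graph → Set
IsTree G = IsSimple G × (1 ≤ size G) × Connected G × ¬ HasCycle G

degree : (G : Graph) → Fin (size G) → ℕ
degree G u = ∣ tabulate (adj G u) ∣

IsLeaf : (G : Graph) → Fin (size G) → Set
IsLeaf G u = degree G u ≡ 1

Height : (G : Graph) → Fin (size G) → ℕ → Set
Height G v h =
  (Σ (Fin (size G)) λ l → IsLeaf G l × Walk G v l h) ×
  (∀ l m → IsLeaf G l → Walk G v l m → h ≤ m)

TreeHeight : Graph → ℕ → Set
TreeHeight G k = (∃ λ v → Height G v k) × (∀ v h → Height G v h → h ≤ k)

Balanced : Graph → Set
Balanced G = ∀ u v h → Adj G u v → Height G u h → Height G v h → ⊥

IsTDS : (G : Graph) → Subset (size G) → Set
IsTDS G S = ∀ v → ∃ λ u → u ∈ S × Adj G v u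

IsMinimalTDS : (G : Graph) → Subset (size G) → Set
IsMinimalTDS G S = IsTDS G S × (∀ S′ → S′ ⊂ S → ¬ IsTDS G S′)

WellTotallyDominated : Graph → Set
WellTotallyDominated G =
  ∀ S S′ → IsMinimalTDS G S → IsMinimalTDS G S′ → ∣ S ∣ ≡ ∣ S′ ∣

-- the path P_m on vertices 0..m
pathAdj : (m : ℕ) → Fin (suc m) → Fin (suc m) → Bool
pathAdj m i j = (suc (toℕ i) ≡ᵇ toℕ j) ∨ (suc (toℕ j) ≡ᵇ toℕ i)

P : ℕ → Graph
P m = graph (suc m) (pathAdj m)

-- attach a new copy of P_m to G by the edge {v, vertex m of the copy};
-- the new vertices are the last (suc m) vertices of Fin (size G + suc m)
attachAdj : (G : Graph) → Fin (size G) → (m : ℕ) →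
            Fin (size G) ⊎ Fin (suc m) → Fin (size G) ⊎ Fin (suc m) → Bool
attachAdj G v m (inj₁ a) (inj₁ b) = adj G a b
attachAdj G v m (inj₂ i) (inj₂ j) = pathAdj m i j
attachAdj G v m (inj₁ a) (inj₂ j) = ⌊ a ≟F v ⌋ ∧ (toℕ j ≡ᵇ m)
attachAdj G v m (inj₂ i) (inj₁ b) = ⌊ b ≟F v ⌋ ∧ (toℕ i ≡ᵇ m)

attach : (G : Graph) → Fin (size G) → ℕ → Graph
attach G v m = graph (size G + suc m)
  (λ x y → attachAdj G v m (splitAt (size G) x) (splitAt (size G) y))

-- length of the path attached to a vertex of height h ∈ {1,2,3}
attachedPath : ℕ → ℕ
attachedPath 1 = 0
attachedPath 2 = 3
attachedPath 3 = 2
attachedPath _ = 0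

O : (G : Graph) → Fin (size G) → ℕ → Graph
O G v h = attach G v (attachedPath h)

ValidHeight : ℕ → Set
ValidHeight h = (h ≡ 1) ⊎ (h ≡ 2) ⊎ (h ≡ 3)

-- OSeq G k H : H = O(G,(v_1,…,v_k)) where each v_j has height 1, 2 or 3
-- in O(G,(v_1,…,v_{j-1})) (heights computed in the current graph)
data OSeq (G : Graph) : ℕ → Graph → Set where
  done : OSeq G 0 G
  step : ∀ {k H} → OSeq G k H → (v : Fin (size H)) (h : ℕ) →
         ValidHeight h → Height H v h → OSeq G (suc k) (O H v h)

_≅_ : Graph → Graph → Set
G ≅ H = Σ (Fin (size G) ↔ Fin (size H)) λ f →
  ∀ u v → adj H (Inverse.to f u) (Inverse.to f v) ≡ adj G u v

{-# OPTIONS --safe #-}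
-- Root T at a vertex v₀ of height 3. As T is balanced, the heights of adjacent vertices differ by
-- exactly one, and well-total domination forbids a vertex of height 2 with two neighbours of height 1
-- as well as a vertex of height 1 with two neighbours of height 2: in either situation every total
-- dominating set inside a suitable set of allowed vertices contains two vertices that a single vertex
-- can replace, which yields a total dominating set smaller than a minimal one.
-- T is then exhausted by a parent-closed copy of an O-sequence, grown from a P₆ through v₀. A vertex
-- t outside the copy whose parent y lies in it has heights (t, y) equal to (0,1), (2,3) or (3,2), the
-- other pairs being ruled out by the forbidden configurations, and t together with a path descending
-- from it to a leaf is exactly what O adds at y.

module Submission where

open import Defs
open import Data.Nat using (ℕ; zero; suc; _+_; _∸_; _⊓_; _≤_; _<_; z≤n; s≤s; _≟_; _≡ᵇ_)
open import Data.Nat.Properties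
  using (≤-refl; ≤-trans; ≤-antisym; ≤-reflexive; ≤-pred; ≤-total; <-irrefl; <-asym; <-cmp; <⇒≤; <⇒≱;
         ≤-<-trans; <-≤-trans; n≤1+n; n<1+n; m<n⇒m<1+n; m≤m+n; m≤n+m; n<1⇒n≡0; n≤0⇒n≡0;
         +-comm; +-suc; +-identityʳ; +-monoʳ-≤; +-monoˡ-≤; suc-injective; 1+n≢0; 1+n≢n; ≡ᵇ⇒≡; ≡⇒≡ᵇ;
         module ≤-Reasoning)
open import Data.Bool using (Bool; true; false; _∧_) renaming (_≟_ to _≟ᵇ_)
open import Data.Bool.Properties using (T-≡; T-∨; T-∧; ⇔→≡)
open import Data.Fin using (Fin; zero; suc; toℕ; fromℕ; inject₁; opposite; splitAt; join; _↑ˡ_)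
open import Data.Fin.Patterns using (0F; 1F; 2F; 3F; 4F; 5F; 6F)
open import Data.Fin.Properties
  using (any?; all?; ¬∀⟶∃¬; injective⇒≤; toℕ-injective; toℕ-inject₁; toℕ-fromℕ; splitAt-join; join-splitAt; splitAt-↑ˡ)
  renaming (_≟_ to _≟F_)
open import Data.Fin.Subset using (Subset; _∈_; _⊆_; ∣_∣; _∪_; _-_; ⁅_⁆; Nonempty)
open import Data.Fin.Subset.Properties
  using (_∈?_; nonempty?; Empty-unique; ∣⊥∣≡0; ∣⁅x⁆∣≡1; x∈⁅x⁆; x∈⁅y⁆⇒x≡y; ⊆-antisym; x∈p⇒∣p-x∣<∣p∣;
         x∈p∧x≢y⇒x∈p-y; p─q⊆p; x∈p∪q⁺; p⊆q⇒∣p∣≤∣q∣)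
open import Data.Vec using (_∷_; []; tabulate)
open import Data.Vec.Properties using (lookup∘tabulate; lookup⇒[]=; []=⇒lookup)
open import Data.Vec.Functional using () renaming (_∷_ to _∷ᶠ_)
open import Data.List using (List; []; _∷_; _∷ʳ_; length)
open import Data.List.Properties using (length-++)
open import Data.List.Relation.Unary.All using (All; []; _∷_)
import Data.List.Relation.Unary.All as All
open import Data.List.Relation.Unary.All.Properties using (∷ʳ⁺; ∷ʳ⁻)
open import Data.List.Relation.Unary.AllPairs using ([]; _∷_)
open import Data.List.Relation.Unary.Linked using (Linked; []; [-]; _∷_)
open import Data.List.Relation.Unary.Unique.Propositional using (Unique)
open import Data.Product using (Σ; ∃; _×_; _,_; proj₁; proj₂)
import Data.Product as Product
open import Data.Sum using (_⊎_; inj₁; inj₂; [_,_])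
import Data.Sum as Sum
open import Data.Empty using (⊥; ⊥-elim)
open import Function using (_∘_; _⇔_; mk⇔; Equivalence; mk↔ₛ′)
open import Function.Properties.Equivalence using () renaming (sym to ⇔-sym; trans to ⇔-trans)
open import Relation.Binary.Definitions using (tri<; tri≈; tri>)
open import Relation.Binary.PropositionalEquality using (_≡_; _≢_; refl; sym; trans; cong; cong₂; subst; subst₂)
open import Relation.Nullary using (¬_; Dec; yes; no; ¬?; contradiction)
open import Relation.Nullary.Decidable using (_×-dec_; _⊎-dec_; _→-dec_; isYes; from-yes; toWitness; fromWitness)

private
  variable
    n : ℕ

∈-tabulate⁺ : (f : Fin n → Bool) {i : Fin n} → f i ≡ true → i ∈ tabulate f
∈-tabulate⁺ f {i} fi = lookup⇒[]= i (tabulate f) (trans (lookup∘tabulate f i) fi)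

∈-tabulate⁻ : (f : Fin n → Bool) {i : Fin n} → i ∈ tabulate f → f i ≡ true
∈-tabulate⁻ f {i} i∈ = trans (sym (lookup∘tabulate f i)) ([]=⇒lookup i∈)

∣p∣≡1⇒≡ : {p : Subset n} {x y : Fin n} → ∣ p ∣ ≡ 1 → x ∈ p → y ∈ p → x ≡ y
∣p∣≡1⇒≡ {p = p} {x} {y} ∣p∣≡1 x∈p y∈p with x ≟F y
... | yes x≡y = x≡y
... | no x≢y = ⊥-elim (<-irrefl (sym (n<1⇒n≡0 ∣p-x∣<1)) (≤-<-trans z≤n (x∈p⇒∣p-x∣<∣p∣ y∈p-x)))
  where
  ∣p-x∣<1 : ∣ p - x ∣ < 1
  ∣p-x∣<1 = subst (∣ p - x ∣ <_) ∣p∣≡1 (x∈p⇒∣p-x∣<∣p∣ x∈p)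
  y∈p-x = x∈p∧x≢y⇒x∈p-y y∈p (x≢y ∘ sym)

∣p∣≡1⁺ : {p : Subset n} {x : Fin n} → x ∈ p → (∀ {y} → y ∈ p → y ≡ x) → ∣ p ∣ ≡ 1
∣p∣≡1⁺ {p = p} {x} x∈p unique =
  trans (cong ∣_∣ (⊆-antisym (λ y∈p → subst (_∈ ⁅ x ⁆) (sym (unique y∈p)) (x∈⁅x⁆ x))
                              (λ y∈⁅x⁆ → subst (_∈ p) (sym (x∈⁅y⁆⇒x≡y x y∈⁅x⁆)) x∈p)))
        (∣⁅x⁆∣≡1 x)

∣p∣≡1⇒nonempty : {p : Subset n} → ∣ p ∣ ≡ 1 → Nonempty p
∣p∣≡1⇒nonempty {n} {p} ∣p∣≡1 with nonempty? p
... | yes ne = ne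
... | no ¬ne = contradiction (trans (sym (∣⊥∣≡0 n)) (trans (cong ∣_∣ (sym (Empty-unique ¬ne))) ∣p∣≡1)) λ ()

∣p∪q∣≤∣p∣+∣q∣ : (p q : Subset n) → ∣ p ∪ q ∣ ≤ ∣ p ∣ + ∣ q ∣
∣p∪q∣≤∣p∣+∣q∣ [] [] = z≤n
∣p∪q∣≤∣p∣+∣q∣ (true ∷ p) (true ∷ q) = s≤s (≤-trans (∣p∪q∣≤∣p∣+∣q∣ p q) (+-monoʳ-≤ ∣ p ∣ (n≤1+n ∣ q ∣)))
∣p∪q∣≤∣p∣+∣q∣ (true ∷ p) (false ∷ q) = s≤s (∣p∪q∣≤∣p∣+∣q∣ p q)
∣p∪q∣≤∣p∣+∣q∣ (false ∷ p) (true ∷ q) =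
  subst (suc ∣ p ∪ q ∣ ≤_) (sym (+-suc ∣ p ∣ ∣ q ∣)) (s≤s (∣p∪q∣≤∣p∣+∣q∣ p q))
∣p∪q∣≤∣p∣+∣q∣ (false ∷ p) (false ∷ q) = ∣p∪q∣≤∣p∣+∣q∣ p q

Least : (ℕ → Set) → ℕ → Set
Least P d = P d × (∀ m → P m → d ≤ m)

least : {P : ℕ → Set} → (∀ k → Dec (P k)) → ∀ {K} → P K → Σ ℕ (Least P)
least P? {zero} p = 0 , p , λ _ _ → z≤n
least P? {suc K} p with P? 0
... | yes p₀ = 0 , p₀ , λ _ _ → z≤n
... | no ¬p₀ with least (P? ∘ suc) p
... | d , pd , d-least = suc d , pd , λ { zero p₀ → contradiction p₀ ¬p₀ ; (suc m) pm → s≤s (d-least m pm) }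

_▷_ : ∀ {A : Set} {n} → (Fin n → A) → A → Fin (suc n) → A
_▷_ {n = zero} g a _ = a
_▷_ {n = suc n} g a zero = g zero
_▷_ {n = suc n} g a (suc i) = ((g ∘ suc) ▷ a) i

▷-inject₁ : ∀ {A : Set} {n} (g : Fin n → A) a i → (g ▷ a) (inject₁ i) ≡ g i
▷-inject₁ {n = suc n} g a zero = refl
▷-inject₁ {n = suc n} g a (suc i) = ▷-inject₁ (g ∘ suc) a i

▷-fromℕ : ∀ {A : Set} {n} (g : Fin n → A) a → (g ▷ a) (fromℕ n) ≡ a
▷-fromℕ {n = zero} g a = refl
▷-fromℕ {n = suc n} g a = ▷-fromℕ (g ∘ suc) a

data LastView : ∀ {n} → Fin (suc n) → Set where
  last : ∀ {n} → LastView (fromℕ n)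
  inner : ∀ {n} (i : Fin n) → LastView (inject₁ i)

lastView : ∀ {n} (j : Fin (suc n)) → LastView j
lastView {zero} zero = last
lastView {suc n} zero = inner zero
lastView {suc n} (suc j) with lastView j
... | last = last
... | inner i = inner (suc i)

splitAt-injective : ∀ m {n} {p q : Fin (m + n)} → splitAt m p ≡ splitAt m q → p ≡ q
splitAt-injective m {n} {p} {q} eq =
  trans (sym (join-splitAt m n p)) (trans (cong (join m n) eq) (join-splitAt m n q))

join-injective : ∀ m n {p q : Fin m ⊎ Fin n} → join m n p ≡ join m n q → p ≡ q
join-injective m n {p} {q} eq =
  trans (sym (splitAt-join m n p)) (trans (cong (splitAt m) eq) (splitAt-join m n q))

successor-view : ∀ {m} (i j : Fin (suc m)) → suc (toℕ i) ≡ toℕ j → Σ (Fin m) λ k → i ≡ inject₁ k × j ≡ suc k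
successor-view i (suc k) i+1≡j = k , toℕ-injective (trans (suc-injective i+1≡j) (sym (toℕ-inject₁ k))) , refl

Vertex : Graph → Set
Vertex G = Fin (size G)

module _ (G : Graph) where

  adj? : ∀ u v → Dec (Adj G u v)
  adj? u v = adj G u v ≟ᵇ true

  leaf-neighbour-unique : ∀ {l u w} → IsLeaf G l → Adj G l u → Adj G l w → u ≡ w
  leaf-neighbour-unique leaf lu lw = ∣p∣≡1⇒≡ leaf (∈-tabulate⁺ (adj G _) lu) (∈-tabulate⁺ (adj G _) lw)

  leaf-neighbour : ∀ {l} → IsLeaf G l → Σ (Vertex G) (Adj G l)
  leaf-neighbour leaf with ∣p∣≡1⇒nonempty leaf
  ... | u , u∈ = u , ∈-tabulate⁻ (adj G _) u∈

  unique-neighbour⇒leaf : ∀ {l u} → Adj G l u → (∀ {w} → Adj G l w → w ≡ u) → IsLeaf G l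
  unique-neighbour⇒leaf lu unique =
    ∣p∣≡1⁺ (∈-tabulate⁺ (adj G _) lu) (λ w∈ → unique (∈-tabulate⁻ (adj G _) w∈))

  another-neighbour : ∀ {v p} → ¬ IsLeaf G v → Adj G v p → Σ (Vertex G) λ w → Adj G v w × w ≢ p
  another-neighbour {v} {p} ¬leaf vp with any? (λ w → adj? v w ×-dec ¬? (w ≟F p))
  ... | yes found = found
  ... | no ¬found = contradiction (unique-neighbour⇒leaf vp only-p) ¬leaf
    where
    only-p : ∀ {w} → Adj G v w → w ≡ p
    only-p {w} vw with w ≟F p
    ... | yes w≡p = w≡p
    ... | no w≢p = contradiction (w , vw , w≢p) ¬found

  Reach : (Vertex G → Set) → ℕ → Vertex G → Set
  Reach P k v = Σ (Vertex G) λ l → P l × Walk G v l k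

  reach? : {P : Vertex G → Set} → (∀ x → Dec (P x)) → ∀ k v → Dec (Reach P k v)
  reach? P? zero v with P? v
  ... | yes pv = yes (v , pv , nil v)
  ... | no ¬pv = no λ { (_ , pl , nil _) → ¬pv pl }
  reach? P? (suc k) v with any? (λ w → adj? v w ×-dec reach? P? k w)
  ... | yes (w , vw , l , pl , walk) = yes (l , pl , cons vw walk)
  ... | no ¬step = no λ { (l , pl , cons {w = w} vw walk) → ¬step (w , vw , l , pl , walk) }

  least⇒height : ∀ {v h} → Least (λ k → Reach (IsLeaf G) k v) h → Height G v h
  least⇒height (reach , minimal) = reach , λ l m leaf walk → minimal m (l , leaf , walk)

  height⇒least : ∀ {v h} → Height G v h → Least (λ k → Reach (IsLeaf G) k v) h
  height⇒least (reach , minimal) = reach , λ { m (l , leaf , walk) → minimal l m leaf walk }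

module Distance (G : Graph) {P : Vertex G → Set} (P? : ∀ x → Dec (P x))
                (reachable : ∀ v → ∃ λ k → Reach G P k v) where

  abstract
    distance : ∀ v → Σ ℕ (Least (λ k → Reach G P k v))
    distance v = least (λ k → reach? G P? k v) (proj₂ (reachable v))

  dist : Vertex G → ℕ
  dist v = proj₁ (distance v)

  dist-least : ∀ v → Least (λ k → Reach G P k v) (dist v)
  dist-least v = proj₂ (distance v)

  dist-unique : ∀ {v d} → Least (λ k → Reach G P k v) d → d ≡ dist v
  dist-unique {v} {d} (reach , minimal) =
    ≤-antisym (minimal (dist v) (proj₁ (dist-least v))) (proj₂ (dist-least v) d reach)

  dist-adj : ∀ {u v} → Adj G u v → dist u ≤ suc (dist v)
  dist-adj {u} {v} uv with proj₁ (dist-least v)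
  ... | l , pl , walk = proj₂ (dist-least u) _ (l , pl , cons uv walk)

  dist≡0⇒ : ∀ {v} → dist v ≡ 0 → P v
  dist≡0⇒ {v} d≡0 with subst (λ d → Reach G P d v) d≡0 (proj₁ (dist-least v))
  ... | _ , pl , nil _ = pl

  ⇒dist≡0 : ∀ {v} → P v → dist v ≡ 0
  ⇒dist≡0 {v} pv = n≤0⇒n≡0 (proj₂ (dist-least v) 0 (v , pv , nil v))

  dist-step : ∀ {v k} → dist v ≡ suc k → Σ (Vertex G) λ w → Adj G v w × dist w ≡ k
  dist-step {v} {k} d≡ with subst (λ d → Reach G P d v) d≡ (proj₁ (dist-least v))
  ... | l , pl , cons {w = w} vw walk =
    w , vw , ≤-antisym (proj₂ (dist-least w) k (l , pl , walk)) (≤-pred (subst (_≤ suc (dist w)) d≡ (dist-adj vw)))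

module SimpleGraph (G : Graph) (simple : IsSimple G) where

  adj-sym : ∀ {u v} → Adj G u v → Adj G v u
  adj-sym {u} {v} uv = trans (proj₁ simple v u) uv

  adj⇒≢ : ∀ {u v} → Adj G u v → u ≢ v
  adj⇒≢ {u} uv refl with trans (sym (proj₂ simple u)) uv
  ... | ()

module _ (G : Graph) (L : Vertex G → ℕ)
         (L≡0⇒leaf : ∀ {x} → L x ≡ 0 → IsLeaf G x) (leaf⇒L≡0 : ∀ {x} → IsLeaf G x → L x ≡ 0)
         (L-descends : ∀ {x k} → L x ≡ suc k → Σ (Vertex G) λ y → Adj G x y × L y ≡ k)
         (L-adj : ∀ {x y} → Adj G x y → L x ≤ suc (L y)) where

  private
    walk-to-leaf : ∀ k {x} → L x ≡ k → Reach G (IsLeaf G) k x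
    walk-to-leaf zero Lx≡0 = _ , L≡0⇒leaf Lx≡0 , nil _
    walk-to-leaf (suc k) Lx≡ with L-descends Lx≡
    ... | y , xy , Ly≡k with walk-to-leaf k Ly≡k
    ... | l , leaf , walk = l , leaf , cons xy walk

    L-walk : ∀ {x l m} → Walk G x l m → L x ≤ m + L l
    L-walk (nil _) = ≤-refl
    L-walk (cons xy walk) = ≤-trans (L-adj xy) (s≤s (L-walk walk))

  labelling-height : ∀ x → Height G x (L x)
  labelling-height x = walk-to-leaf (L x) refl , λ l m leaf walk →
    subst (L x ≤_) (trans (cong (m +_) (leaf⇒L≡0 leaf)) (+-identityʳ m)) (L-walk walk)

Consecutive : Fin n → Fin n → Set
Consecutive i j = suc (toℕ i) ≡ toℕ j ⊎ suc (toℕ j) ≡ toℕ i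

pathAdj⇔Consecutive : ∀ {m} {i j : Fin (suc m)} → pathAdj m i j ≡ true ⇔ Consecutive i j
pathAdj⇔Consecutive = ⇔-trans (⇔-sym T-≡)
  (⇔-trans T-∨ (mk⇔ (Sum.map (≡ᵇ⇒≡ _ _) (≡ᵇ⇒≡ _ _)) (Sum.map (≡⇒≡ᵇ _ _) (≡⇒≡ᵇ _ _))))

steps⇒Consecutive : ∀ {A : Set} {m} {R : A → A → Set} → (∀ {x y} → R x y → R y x) → (g : Fin (suc m) → A) →
                    (∀ (k : Fin m) → R (g (inject₁ k)) (g (suc k))) → ∀ {i j} → Consecutive i j → R (g i) (g j)
steps⇒Consecutive R-sym g link {i} {j} (inj₁ i+1≡j) with successor-view i j i+1≡j
... | k , refl , refl = link k
steps⇒Consecutive R-sym g link {i} {j} (inj₂ j+1≡i) with successor-view j i j+1≡i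
... | k , refl , refl = R-sym (link k)

path-embedding : ∀ (G : Graph) {m} (g : Fin (suc m) → Vertex G) →
                 (∀ {i j} → Adj G (g i) (g j) ⇔ Consecutive i j) → ∀ i j → pathAdj m i j ≡ adj G (g i) (g j)
path-embedding G g edges i j = ⇔→≡ (⇔-trans pathAdj⇔Consecutive (⇔-sym edges))

Consecutive? : ∀ {n} (i j : Fin n) → Dec (Consecutive i j)
Consecutive? i j = (suc (toℕ i) ≟ toℕ j) ⊎-dec (suc (toℕ j) ≟ toℕ i)

P₆-height : Fin 7 → ℕ
P₆-height i = toℕ i ⊓ (6 ∸ toℕ i)

P₆-height-mirror : ∀ i j → P₆-height i ≡ P₆-height j → i ≡ j ⊎ j ≡ opposite i
P₆-height-mirror = from-yes (all? λ i → all? λ j →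
  (P₆-height i ≟ P₆-height j) →-dec ((i ≟F j) ⊎-dec (j ≟F opposite i)))

P₆-height-descends : ∀ i → P₆-height i ≢ 0 → Σ (Fin 7) λ j → Consecutive i j × suc (P₆-height j) ≡ P₆-height i
P₆-height-descends = from-yes (all? λ i → ¬? (P₆-height i ≟ 0) →-dec
  any? λ j → Consecutive? i j ×-dec (suc (P₆-height j) ≟ P₆-height i))

P₆-inner-branches : ∀ i → P₆-height i ≢ 0 →
                    Σ (Fin 7) λ j → Σ (Fin 7) λ j′ → j ≢ j′ × Consecutive i j × Consecutive i j′
P₆-inner-branches = from-yes (all? λ i → ¬? (P₆-height i ≟ 0) →-dec
  any? λ j → any? λ j′ → ¬? (j ≟F j′) ×-dec Consecutive? i j ×-dec Consecutive? i j′)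

-- Total domination

module TotalDomination (G : Graph) where

  IsTDS? : ∀ S → Dec (IsTDS G S)
  IsTDS? S = all? λ v → any? λ u → (u ∈? S) ×-dec adj? G v u

  IsTDS-⊆ : ∀ {S S′} → S ⊆ S′ → IsTDS G S → IsTDS G S′
  IsTDS-⊆ S⊆S′ tds v with tds v
  ... | u , u∈S , vu = u , S⊆S′ u∈S , vu

  minimal-TDS-⊆ : ∀ {S₀} → IsTDS G S₀ → Σ (Subset (size G)) λ S → S ⊆ S₀ × IsMinimalTDS G S
  minimal-TDS-⊆ {S₀} = shrink (suc ∣ S₀ ∣) ≤-refl
    where
    shrink : ∀ fuel {S} → ∣ S ∣ < fuel → IsTDS G S → Σ (Subset (size G)) λ S′ → S′ ⊆ S × IsMinimalTDS G S′
    shrink (suc fuel) {S} ∣S∣<fuel tds with any? (λ x → (x ∈? S) ×-dec IsTDS? (S - x))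
    ... | yes (x , x∈S , tds-x) with shrink fuel (≤-trans (x∈p⇒∣p-x∣<∣p∣ x∈S) (≤-pred ∣S∣<fuel)) tds-x
    ...   | S′ , S′⊆S-x , minimal = S′ , p─q⊆p S ⁅ x ⁆ ∘ S′⊆S-x , minimal
    shrink (suc fuel) {S} ∣S∣<fuel tds | no irreducible =
      S , (λ x∈S → x∈S) , tds , λ { S′ (S′⊆S , x , x∈S , x∉S′) tds′ →
        irreducible (x , x∈S , IsTDS-⊆ (λ y∈S′ → x∈p∧x≢y⇒x∈p-y (S′⊆S y∈S′) λ { refl → x∉S′ y∈S′ }) tds′) }

  minimal-TDS-size : WellTotallyDominated G → ∀ {S S′} → IsMinimalTDS G S → IsTDS G S′ → ∣ S ∣ ≤ ∣ S′ ∣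
  minimal-TDS-size wtd minimal tds with minimal-TDS-⊆ tds
  ... | S″ , S″⊆S′ , minimal″ = subst (_≤ _) (wtd _ _ minimal″ minimal) (p⊆q⇒∣p∣≤∣q∣ S″⊆S′)

  record TwoForOne (S : Subset (size G)) : Set where
    field
      x y z : Vertex G
      x∈S : x ∈ S
      y∈S : y ∈ S
      x≢y : x ≢ y
      dominated : ∀ v → (Σ (Vertex G) λ u → u ∈ S × u ≢ x × u ≢ y × Adj G v u) ⊎ Adj G v z

    swapped : Subset (size G)
    swapped = (S - x - y) ∪ ⁅ z ⁆

    swapped-TDS : IsTDS G swapped
    swapped-TDS v with dominated v
    ... | inj₁ (u , u∈S , u≢x , u≢y , vu) = u , x∈p∪q⁺ (inj₁ (x∈p∧x≢y⇒x∈p-y (x∈p∧x≢y⇒x∈p-y u∈S u≢x) u≢y)) , vu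
    ... | inj₂ vz = z , x∈p∪q⁺ (inj₂ (x∈⁅x⁆ z)) , vz

    ∣swapped∣<∣S∣ : ∣ swapped ∣ < ∣ S ∣
    ∣swapped∣<∣S∣ = begin-strict
      ∣ swapped ∣               ≤⟨ ∣p∪q∣≤∣p∣+∣q∣ (S - x - y) ⁅ z ⁆ ⟩
      ∣ S - x - y ∣ + ∣ ⁅ z ⁆ ∣ ≡⟨ cong (∣ S - x - y ∣ +_) (∣⁅x⁆∣≡1 z) ⟩
      ∣ S - x - y ∣ + 1         ≡⟨ +-comm _ 1 ⟩
      suc ∣ S - x - y ∣         ≤⟨ x∈p⇒∣p-x∣<∣p∣ (x∈p∧x≢y⇒x∈p-y y∈S (x≢y ∘ sym)) ⟩
      ∣ S - x ∣                 <⟨ x∈p⇒∣p-x∣<∣p∣ x∈S ⟩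
      ∣ S ∣                     ∎
      where open ≤-Reasoning

  wtd⇒¬TwoForOne : WellTotallyDominated G → ∀ {S} → IsMinimalTDS G S → ¬ TwoForOne S
  wtd⇒¬TwoForOne wtd minimal swap =
    <⇒≱ (TwoForOne.∣swapped∣<∣S∣ swap) (minimal-TDS-size wtd minimal (TwoForOne.swapped-TDS swap))

  wtd⇒¬TwoForOne-within : WellTotallyDominated G → {A : Vertex G → Set} → (∀ v → Dec (A v)) →
    (∀ v → Σ (Vertex G) λ u → A u × Adj G v u) →
    (∀ {S} → (∀ {u} → u ∈ S → A u) → IsTDS G S → TwoForOne S) → ⊥
  wtd⇒¬TwoForOne-within wtd A? A-dominates swap with minimal-TDS-⊆ A-TDS
    where
    A-TDS : IsTDS G (tabulate (isYes ∘ A?))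
    A-TDS v with A-dominates v
    ... | u , au , vu = u , ∈-tabulate⁺ _ (Equivalence.to T-≡ (fromWitness au)) , vu
  ... | S , S⊆A , minimal =
    wtd⇒¬TwoForOne wtd minimal
      (swap (λ u∈S → toWitness (Equivalence.from T-≡ (∈-tabulate⁻ _ (S⊆A u∈S)))) (proj₁ minimal))

-- Rooted trees and heights

linked-∷ʳ : ∀ {A : Set} {R : A → A → Set} {x y : A} (xs : List A) →
            Linked R (xs ∷ʳ x) → R x y → Linked R (xs ∷ʳ x ∷ʳ y)
linked-∷ʳ [] _ xy = xy ∷ [-]
linked-∷ʳ (_ ∷ []) (r ∷ [-]) xy = r ∷ xy ∷ [-]
linked-∷ʳ (_ ∷ w ∷ zs) (r ∷ rs) xy = r ∷ linked-∷ʳ (w ∷ zs) rs xy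

unique-∷ʳ : ∀ {A : Set} {y : A} {xs : List A} → Unique xs → All (_≢ y) xs → Unique (xs ∷ʳ y)
unique-∷ʳ [] [] = [] ∷ []
unique-∷ʳ (x∉ ∷ u) (x≢y ∷ xs≢y) = ∷ʳ⁺ x∉ x≢y ∷ unique-∷ʳ u xs≢y

module Tree (T : Graph) (simple : IsSimple T) (connected : Connected T) (acyclic : ¬ HasCycle T) where

  open SimpleGraph T simple public

  V : Set
  V = Vertex T

  module Rooted (r : V) where

    root-reachable : ∀ v → ∃ λ k → Reach T (_≡ r) k v
    root-reachable v = proj₁ (connected v r) , r , refl , proj₂ (connected v r)

    open Distance T (_≟F r) root-reachable public
      using ()
      renaming (dist to depth; dist≡0⇒ to depth≡0⇒root; ⇒dist≡0 to depth-of-root;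
                dist-step to depth-step; dist-adj to depth-adj)

    _childOf_ : V → V → Set
    u childOf w = Adj T u w × depth u ≡ suc (depth w)

    _childOf?_ : ∀ u w → Dec (u childOf w)
    u childOf? w = adj? T u w ×-dec (depth u ≟ suc (depth w))

    root-has-no-parent : ∀ {w} → ¬ r childOf w
    root-has-no-parent (_ , d≡) with trans (sym (depth-of-root refl)) d≡
    ... | ()

    parent : ∀ {v} → v ≢ r → Σ V (v childOf_)
    parent {v} v≢r with depth v in d≡
    ... | zero = contradiction (depth≡0⇒root d≡) v≢r
    ... | suc k with depth-step d≡
    ...   | p , vp , dp≡k = p , vp , cong suc (sym dp≡k)

    childOf-asym : ∀ {u w} → u childOf w → ¬ w childOf u
    childOf-asym (_ , du≡) (_ , dw≡) = <-asym (≤-reflexive (sym du≡)) (≤-reflexive (sym dw≡))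

    record DeepPath (a b : V) : Set where
      field
        interior : List V
        interior≢[] : 1 ≤ length interior
        unique : Unique (a ∷ interior ∷ʳ b)
        linked : Linked (Adj T) (a ∷ interior ∷ʳ b)
        deep : All (λ x → depth a ≤ depth x × depth b ≤ depth x) interior

    private
      2≤length-∷ʳ : ∀ {A : Set} (xs : List A) {y} → 1 ≤ length xs → 2 ≤ length (xs ∷ʳ y)
      2≤length-∷ʳ xs 1≤ = subst (2 ≤_) (sym (length-++ xs)) (+-monoˡ-≤ 1 1≤)

      endpoints-distinct : ∀ {a b} → DeepPath a b → a ≢ b
      endpoints-distinct path with DeepPath.unique path
      ... | a∉ ∷ _ = proj₂ (∷ʳ⁻ a∉)

      close : ∀ {a b} → Adj T b a → ¬ DeepPath a b
      close {a} {b} ba path =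
        acyclic (a , interior ∷ʳ b , 2≤length-∷ʳ interior interior≢[] , unique , linked-∷ʳ (a ∷ interior) linked ba)
        where open DeepPath path

      extend-front : ∀ {a b p} → depth b ≤ depth a → a childOf p → p ≢ b → DeepPath a b → DeepPath p b
      extend-front {a} {b} {p} b≤a (ap , da≡) p≢b path = record
        { interior = a ∷ interior
        ; interior≢[] = s≤s z≤n
        ; unique = (p≢a ∷ ∷ʳ⁺ (All.map (λ {x} (a≤x , _) → p≢x a≤x) deep) p≢b) ∷ unique
        ; linked = adj-sym ap ∷ linked
        ; deep = (p≤a , b≤a) ∷ All.map (λ (a≤x , b≤x) → ≤-trans p≤a a≤x , b≤x) deep
        }
        where
        open DeepPath path
        p<a : depth p < depth a
        p<a = ≤-reflexive (sym da≡)
        p≤a = <⇒≤ p<a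
        p≢a = adj⇒≢ (adj-sym ap)
        p≢x : ∀ {x} → depth a ≤ depth x → p ≢ x
        p≢x a≤x refl = <-irrefl refl (<-≤-trans p<a a≤x)

      extend-back : ∀ {a b q} → depth a ≤ depth b → b childOf q → q ≢ a → DeepPath a b → DeepPath a q
      extend-back {a} {b} {q} a≤b (bq , db≡) q≢a path = record
        { interior = interior ∷ʳ b
        ; interior≢[] = subst (1 ≤_) (sym (length-++ interior)) (m≤n+m 1 _)
        ; unique = unique-∷ʳ unique ((q≢a ∘ sym) ∷ ∷ʳ⁺ (All.map (λ {x} (_ , b≤x) → x≢q b≤x) deep) (adj⇒≢ bq))
        ; linked = linked-∷ʳ (a ∷ interior) linked bq
        ; deep = ∷ʳ⁺ (All.map (λ (a≤x , b≤x) → a≤x , ≤-trans q≤b b≤x) deep) (a≤b , q≤b)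
        }
        where
        open DeepPath path
        q<b : depth q < depth b
        q<b = ≤-reflexive (sym db≡)
        q≤b = <⇒≤ q<b
        x≢q : ∀ {x} → depth b ≤ depth x → x ≢ q
        x≢q b≤x refl = <-irrefl refl (<-≤-trans q<b b≤x)

      shallow-end-is-root : ∀ {a b} → depth b ≤ depth a → a ≡ r → b ≡ r
      shallow-end-is-root {b = b} b≤a refl = depth≡0⇒root (n≤0⇒n≡0 (subst (depth b ≤_) (depth-of-root refl) b≤a))

    -- A path whose interior is at least as deep as its ends can be extended at its shallower end
    -- towards the root until it closes a cycle.
    no-deep-path : ∀ {a b} → ¬ DeepPath a b
    no-deep-path = shorten _ ≤-refl
      where
      shorten : ∀ fuel {a b} → depth a + depth b < fuel → ¬ DeepPath a b
      shorten (suc fuel) {a} {b} lt path with ≤-total (depth b) (depth a)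
      ... | inj₁ b≤a with a ≟F r
      ...   | yes a≡r = endpoints-distinct path (trans a≡r (sym (shallow-end-is-root b≤a a≡r)))
      ...   | no a≢r with parent a≢r
      ...     | p , ap with p ≟F b
      ...       | yes refl = close (adj-sym (proj₁ ap)) path
      ...       | no p≢b =
        shorten fuel (subst (λ d → d + depth b ≤ fuel) (proj₂ ap) (≤-pred lt)) (extend-front b≤a ap p≢b path)
      shorten (suc fuel) {a} {b} lt path | inj₂ a≤b with b ≟F r
      ...   | yes b≡r = endpoints-distinct path (trans (shallow-end-is-root a≤b b≡r) (sym b≡r))
      ...   | no b≢r with parent b≢r
      ...     | q , bq with q ≟F a
      ...       | yes refl = close (proj₁ bq) path
      ...       | no q≢a = shorten fuel measure (extend-back a≤b bq q≢a path)
        where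
        measure : depth a + depth q < fuel
        measure = subst (_≤ fuel) (+-suc (depth a) (depth q)) (subst (λ d → depth a + d ≤ fuel) (proj₂ bq) (≤-pred lt))

    low-neighbours-equal : ∀ {z y₁ y₂} → Adj T z y₁ → Adj T z y₂ →
                           depth y₁ ≤ depth z → depth y₂ ≤ depth z → y₁ ≡ y₂
    low-neighbours-equal {z} {y₁} {y₂} zy₁ zy₂ y₁≤z y₂≤z with y₁ ≟F y₂
    ... | yes y₁≡y₂ = y₁≡y₂
    ... | no y₁≢y₂ = ⊥-elim (no-deep-path record
      { interior = z ∷ []
      ; interior≢[] = s≤s z≤n
      ; unique = (adj⇒≢ (adj-sym zy₁) ∷ y₁≢y₂ ∷ []) ∷ (adj⇒≢ zy₂ ∷ []) ∷ [] ∷ []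
      ; linked = adj-sym zy₁ ∷ zy₂ ∷ [-]
      ; deep = (y₁≤z , y₂≤z) ∷ []
      })

    parent-unique : ∀ {u a b} → u childOf a → u childOf b → a ≡ b
    parent-unique (ua , du≡) (ub , du≡′) =
      low-neighbours-equal ua ub (subst (_ ≤_) (sym du≡) (n≤1+n _)) (subst (_ ≤_) (sym du≡′) (n≤1+n _))

    adj⇒childOf : ∀ {u w} → Adj T u w → u childOf w ⊎ w childOf u
    adj⇒childOf {u} {w} uw with <-cmp (depth u) (depth w)
    ... | tri< u<w _ _ = inj₂ (adj-sym uw , ≤-antisym (depth-adj (adj-sym uw)) u<w)
    ... | tri> _ _ w<u = inj₁ (uw , ≤-antisym (depth-adj uw) w<u)
    ... | tri≈ _ du≡dw _ with u ≟F r
    ...   | yes refl = ⊥-elim (adj⇒≢ uw (sym (depth≡0⇒root (trans (sym du≡dw) (depth-of-root refl)))))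
    ...   | no u≢r with parent u≢r
    ...     | p , up , du≡ with low-neighbours-equal uw up (≤-reflexive (sym du≡dw)) (subst (_ ≤_) (sym du≡) (n≤1+n _))
    ...       | refl = ⊥-elim (1+n≢n (trans (sym du≡) du≡dw))

    neighbour-is-child : ∀ {u w p} → Adj T u w → u childOf p → w ≢ p → w childOf u
    neighbour-is-child uw up w≢p with adj⇒childOf uw
    ... | inj₁ uw′ = ⊥-elim (w≢p (parent-unique uw′ up))
    ... | inj₂ wu = wu

    root-neighbour-is-child : ∀ {w} → Adj T r w → w childOf r
    root-neighbour-is-child rw with adj⇒childOf rw
    ... | inj₁ rw′ = ⊥-elim (root-has-no-parent rw′)
    ... | inj₂ wr = wr

  module Height3 (balanced : Balanced T) (v₀ : V) (v₀-Height : Height T v₀ 3)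
                 (Height≤3 : ∀ v h → Height T v h → h ≤ 3) where

    private
      ℓ : V
      ℓ = proj₁ (proj₁ v₀-Height)

      ℓ-leaf : IsLeaf T ℓ
      ℓ-leaf = proj₁ (proj₂ (proj₁ v₀-Height))

      leaf-reachable : ∀ v → ∃ λ k → Reach T (IsLeaf T) k v
      leaf-reachable v = proj₁ (connected v ℓ) , ℓ , ℓ-leaf , proj₂ (connected v ℓ)

    open Distance T (λ x → degree T x ≟ 1) leaf-reachable
      renaming (dist to height; dist-least to height-least; dist-unique to height-unique;
                dist≡0⇒ to height≡0⇒leaf; ⇒dist≡0 to leaf⇒height≡0; dist-step to height-step; dist-adj to height-adj)
      public

    Height-height : ∀ v → Height T v (height v)
    Height-height v = least⇒height T (height-least v)

    Height⇒≡height : ∀ {v h} → Height T v h → h ≡ height v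
    Height⇒≡height H = height-unique (height⇒least T H)

    height-v₀ : height v₀ ≡ 3
    height-v₀ = sym (Height⇒≡height v₀-Height)

    height≤3 : ∀ v → height v ≤ 3
    height≤3 v = Height≤3 v _ (Height-height v)

    height≢4 : ∀ {v} → height v ≢ 4
    height≢4 {v} hv = contradiction (subst (_≤ 3) hv (height≤3 v)) λ { (s≤s (s≤s (s≤s ()))) }

    height-cases : ∀ v → height v ≡ 0 ⊎ height v ≡ 1 ⊎ height v ≡ 2 ⊎ height v ≡ 3
    height-cases v with height v | height≤3 v
    ... | 0 | _ = inj₁ refl
    ... | 1 | _ = inj₂ (inj₁ refl)
    ... | 2 | _ = inj₂ (inj₂ (inj₁ refl))
    ... | 3 | _ = inj₂ (inj₂ (inj₂ refl))
    ... | suc (suc (suc (suc _))) | s≤s (s≤s (s≤s ()))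

    adjacent-heights : ∀ {u w} → Adj T u w → height u ≡ suc (height w) ⊎ height w ≡ suc (height u)
    adjacent-heights {u} {w} uw with <-cmp (height u) (height w)
    ... | tri< u<w _ _ = inj₂ (≤-antisym (height-adj (adj-sym uw)) u<w)
    ... | tri> _ _ w<u = inj₁ (≤-antisym (height-adj uw) w<u)
    ... | tri≈ _ hu≡hw _ =
      ⊥-elim (balanced u w (height u) uw (Height-height u) (subst (Height T w) (sym hu≡hw) (Height-height w)))

    height≢ : ∀ {v i j} → height v ≡ i → i ≢ j → height v ≢ j
    height≢ hv i≢j hv≡j = i≢j (trans (sym hv) hv≡j)

    ≢-by-height : ∀ {u w i j} → height u ≡ i → height w ≡ j → i ≢ j → u ≢ w
    ≢-by-height refl hw i≢j refl = i≢j hw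

    ¬adj-by-height : ∀ {u w i j} → height u ≡ i → height w ≡ j → i ≢ suc j → j ≢ suc i → ¬ Adj T u w
    ¬adj-by-height refl refl i≢1+j j≢1+i uw with adjacent-heights uw
    ... | inj₁ i≡1+j = i≢1+j i≡1+j
    ... | inj₂ j≡1+i = j≢1+i j≡1+i

    neighbour-of-height3 : ∀ {u w} → height u ≡ 3 → Adj T u w → height w ≡ 2
    neighbour-of-height3 hu uw with adjacent-heights uw
    ... | inj₁ hu≡ = suc-injective (trans (sym hu≡) hu)
    ... | inj₂ hw≡ = ⊥-elim (height≢4 (trans hw≡ (cong suc hu)))

    neighbour-of-height0 : ∀ {u w} → height u ≡ 0 → Adj T u w → height w ≡ 1
    neighbour-of-height0 hu uw with adjacent-heights uw
    ... | inj₁ hu≡ = contradiction (trans (sym hu) hu≡) λ ()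
    ... | inj₂ hw≡ = trans hw≡ (cong suc hu)

    neighbour : ∀ v → Σ V (Adj T v)
    neighbour v with height v in hv
    ... | zero = leaf-neighbour T (height≡0⇒leaf hv)
    ... | suc _ = let w , vw , _ = height-step hv in w , vw

    another-neighbour-of-inner : ∀ {v p} → height v ≢ 0 → Adj T v p → Σ V λ w → Adj T v w × w ≢ p
    another-neighbour-of-inner hv≢0 = another-neighbour T (hv≢0 ∘ leaf⇒height≡0)

    module RootedAt (r : V) where

      open Rooted r public

      lower-child : ∀ {w p k} → w childOf p → height w ≡ suc k → height p ≢ k →
                    Σ V λ c → c childOf w × height c ≡ k
      lower-child {w} {p} (wp , dw≡) hw hp≢k with height-step hw
      ... | c , wc , hc = c , neighbour-is-child wc (wp , dw≡) (λ { refl → hp≢k hc }) , hc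

      another-child : ∀ {w p} → w childOf p → height w ≢ 0 → Σ V (_childOf w)
      another-child wp hw≢0 with another-neighbour-of-inner hw≢0 (proj₁ wp)
      ... | c , wc , c≢p = c , neighbour-is-child wc wp c≢p

      leaf-is-child : ∀ {l u} → height l ≡ 0 → l ≢ r → Adj T l u → l childOf u
      leaf-is-child hl l≢r lu with parent l≢r
      ... | p , lp = subst (_ childOf_) (leaf-neighbour-unique T (height≡0⇒leaf hl) (proj₁ lp) lu) lp

    -- Two configurations forbidden by well-total domination

    module _ (wtd : WellTotallyDominated T) where

      open TotalDomination T using (TwoForOne; wtd⇒¬TwoForOne-within)

      private
        module TwoHeight1Neighbours {d a₁ a₂ l₁ l₂} (hd : height d ≡ 2) (da₁ : Adj T d a₁) (da₂ : Adj T d a₂)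
                                    (ha₁ : height a₁ ≡ 1) (ha₂ : height a₂ ≡ 1) (a₁≢a₂ : a₁ ≢ a₂)
                                    (a₁l₁ : Adj T a₁ l₁) (hl₁ : height l₁ ≡ 0) (a₂l₂ : Adj T a₂ l₂) (hl₂ : height l₂ ≡ 0) where

          open RootedAt d

          only-a₁ : ∀ {z} → Adj T z l₁ → z ≡ a₁
          only-a₁ zl₁ = leaf-neighbour-unique T (height≡0⇒leaf hl₁) (adj-sym zl₁) (adj-sym a₁l₁)

          only-a₂ : ∀ {z} → Adj T z l₂ → z ≡ a₂
          only-a₂ zl₂ = leaf-neighbour-unique T (height≡0⇒leaf hl₂) (adj-sym zl₂) (adj-sym a₂l₂)

          -- Inside Allowed, a₁ and a₂ can only be dominated by l₁ and l₂, and d takes over both.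
          Allowed : V → Set
          Allowed x = x ≡ l₁ ⊎ x ≡ l₂ ⊎ (¬ Adj T x a₁ × ¬ Adj T x a₂)

          Allowed? : ∀ x → Dec (Allowed x)
          Allowed? x = (x ≟F l₁) ⊎-dec (x ≟F l₂) ⊎-dec (¬? (adj? T x a₁) ×-dec ¬? (adj? T x a₂))

          height1-allowed : ∀ {y} → height y ≡ 1 → Allowed y
          height1-allowed hy = inj₂ (inj₂ (¬adj-by-height hy ha₁ (λ ()) (λ ()) , ¬adj-by-height hy ha₂ (λ ()) (λ ())))

          grandchild-allowed : ∀ {z y} → height z ≡ 3 → y childOf z → Allowed y
          grandchild-allowed {z} {y} hz yz = inj₂ (inj₂ (not-adj ha₁ da₁ , not-adj ha₂ da₂))
            where
            not-adj : ∀ {a} → height a ≡ 1 → Adj T d a → ¬ Adj T y a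
            not-adj ha da ya with adj⇒childOf ya
            ... | inj₁ ya′ = ≢-by-height hz ha (λ ()) (parent-unique yz ya′)
            ... | inj₂ ay = root-has-no-parent (subst (_childOf z) (parent-unique ay (root-neighbour-is-child da)) yz)

          allowed-dominates : ∀ z → Σ V λ u → Allowed u × Adj T z u
          allowed-dominates z with height-cases z
          ... | inj₁ hz = let u , zu = neighbour z in u , height1-allowed (neighbour-of-height0 hz zu) , zu
          ... | inj₂ (inj₂ (inj₁ hz)) = let u , zu , hu = height-step hz in u , height1-allowed hu , zu
          ... | inj₂ (inj₂ (inj₂ hz)) with parent (≢-by-height hz hd λ ())
          ...   | p , zp with another-child zp (height≢ hz λ ())
          ...     | y , yz = y , grandchild-allowed hz yz , adj-sym (proj₁ yz)
          allowed-dominates z | inj₂ (inj₁ hz) with z ≟F a₁ | z ≟F a₂ | height-step hz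
          ... | yes refl | _ | _ = l₁ , inj₁ refl , a₁l₁
          ... | no _ | yes refl | _ = l₂ , inj₂ (inj₁ refl) , a₂l₂
          ... | no z≢a₁ | no z≢a₂ | y , zy , hy = y , inj₂ (inj₂ (not-adj z≢a₁ , not-adj z≢a₂)) , zy
            where
            not-adj : ∀ {a} → z ≢ a → ¬ Adj T y a
            not-adj z≢a ya = z≢a (leaf-neighbour-unique T (height≡0⇒leaf hy) (adj-sym zy) ya)

          swap : ∀ {S} → (∀ {u} → u ∈ S → Allowed u) → IsTDS T S → TwoForOne S
          swap {S} S-allowed S-TDS = record
            { x = l₁ ; y = l₂ ; z = d
            ; x∈S = l₁∈S ; y∈S = l₂∈S ; x≢y = λ l₁≡l₂ → a₁≢a₂ (only-a₂ (subst (Adj T a₁) l₁≡l₂ a₁l₁))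
            ; dominated = dominated
            }
            where
            l₁∈S : l₁ ∈ S
            l₁∈S with S-TDS a₁
            ... | u , u∈S , a₁u with S-allowed u∈S
            ...   | inj₁ refl = u∈S
            ...   | inj₂ (inj₁ refl) = ⊥-elim (a₁≢a₂ (only-a₂ a₁u))
            ...   | inj₂ (inj₂ (¬ua₁ , _)) = ⊥-elim (¬ua₁ (adj-sym a₁u))
            l₂∈S : l₂ ∈ S
            l₂∈S with S-TDS a₂
            ... | u , u∈S , a₂u with S-allowed u∈S
            ...   | inj₁ refl = ⊥-elim (a₁≢a₂ (sym (only-a₁ a₂u)))
            ...   | inj₂ (inj₁ refl) = u∈S
            ...   | inj₂ (inj₂ (_ , ¬ua₂)) = ⊥-elim (¬ua₂ (adj-sym a₂u))
            dominated : ∀ v → (Σ V λ u → u ∈ S × u ≢ l₁ × u ≢ l₂ × Adj T v u) ⊎ Adj T v d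
            dominated v with v ≟F a₁ | v ≟F a₂ | S-TDS v
            ... | yes refl | _ | _ = inj₂ (adj-sym da₁)
            ... | no _ | yes refl | _ = inj₂ (adj-sym da₂)
            ... | no v≢a₁ | no v≢a₂ | u , u∈S , vu =
              inj₁ (u , u∈S , (λ { refl → v≢a₁ (only-a₁ vu) }) , (λ { refl → v≢a₂ (only-a₂ vu) }) , vu)

          impossible : ⊥
          impossible = wtd⇒¬TwoForOne-within wtd Allowed? allowed-dominates swap

      unique-height1-neighbour : ∀ {d a₁ a₂} → height d ≡ 2 → Adj T d a₁ → Adj T d a₂ →
                                 height a₁ ≡ 1 → height a₂ ≡ 1 → a₁ ≡ a₂
      unique-height1-neighbour {a₁ = a₁} {a₂} hd da₁ da₂ ha₁ ha₂ with a₁ ≟F a₂ | height-step ha₁ | height-step ha₂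
      ... | yes a₁≡a₂ | _ | _ = a₁≡a₂
      ... | no a₁≢a₂ | l₁ , a₁l₁ , hl₁ | l₂ , a₂l₂ , hl₂ =
        ⊥-elim (TwoHeight1Neighbours.impossible hd da₁ da₂ ha₁ ha₂ a₁≢a₂ a₁l₁ hl₁ a₂l₂ hl₂)

      private
        module TwoHeight2Neighbours {a b c} (ha : height a ≡ 1) (ab : Adj T a b) (ac : Adj T a c)
                                    (hb : height b ≡ 2) (hc : height c ≡ 2) (b≢c : b ≢ c) where

          open RootedAt a

          b-child : b childOf a
          b-child = root-neighbour-is-child ab

          c-child : c childOf a
          c-child = root-neighbour-is-child ac

          height3-child : ∀ {x} → height x ≡ 2 → x childOf a → Σ V λ y → y childOf x × height y ≡ 3
          height3-child hx xa with another-child xa (height≢ hx λ ())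
          ... | y , yx with adjacent-heights (proj₁ yx)
          ...   | inj₁ hy≡ = y , yx , trans hy≡ (cong suc hx)
          ...   | inj₂ hx≡ = ⊥-elim (root-has-no-parent (subst (_childOf _) (sym a≡y) yx))
            where
            a≡y = unique-height1-neighbour hx (proj₁ xa) (adj-sym (proj₁ yx)) ha (suc-injective (trans (sym hx≡) hx))

          module Configuration {u v d e f} (ub : u childOf b) (hu : height u ≡ 3) (vc : v childOf c) (hv : height v ≡ 3)
                               (dv : d childOf v) (hd : height d ≡ 2) (ed : e childOf d) (he : height e ≡ 1)
                               (fe : f childOf e) (hf : height f ≡ 0) where

            Cousin : V → Set
            Cousin x = height x ≡ 1 × Σ V λ d′ → Σ V λ w → x childOf d′ × d′ childOf w × w childOf c × w ≢ v

            Cousin? : ∀ x → Dec (Cousin x)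
            Cousin? x = (height x ≟ 1) ×-dec
              any? λ d′ → any? λ w → x childOf? d′ ×-dec d′ childOf? w ×-dec w childOf? c ×-dec ¬? (w ≟F v)

            -- Outside Excluded, v, u and e can only be dominated by c, b and f. Trading c and f for d
            -- leaves undominated only the children w ≢ v of c; the children of the cousins below w are
            -- excluded so that the cousins' parents, which dominate w, are forced into the set.
            Excluded : V → Set
            Excluded z = z childOf v ⊎ z childOf u ⊎ (z childOf e × z ≢ f) ⊎ Σ V λ x → z childOf x × Cousin x

            Excluded? : ∀ z → Dec (Excluded z)
            Excluded? z = z childOf? v ⊎-dec z childOf? u ⊎-dec (z childOf? e ×-dec ¬? (z ≟F f)) ⊎-dec
              any? λ x → z childOf? x ×-dec Cousin? x

            height1-allowed : ∀ {y} → height y ≡ 1 → ¬ Excluded y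
            height1-allowed hy (inj₁ (yv , _)) = ¬adj-by-height hy hv (λ ()) (λ ()) yv
            height1-allowed hy (inj₂ (inj₁ (yu , _))) = ¬adj-by-height hy hu (λ ()) (λ ()) yu
            height1-allowed hy (inj₂ (inj₂ (inj₁ ((ye , _) , _)))) = ¬adj-by-height hy he (λ ()) (λ ()) ye
            height1-allowed hy (inj₂ (inj₂ (inj₂ (x , (yx , _) , hx , _)))) = ¬adj-by-height hy hx (λ ()) (λ ()) yx

            child-of-a-allowed : ∀ {y} → y childOf a → ¬ Excluded y
            child-of-a-allowed ya (inj₁ yv) = ≢-by-height hv ha (λ ()) (parent-unique yv ya)
            child-of-a-allowed ya (inj₂ (inj₁ yu)) = ≢-by-height hu ha (λ ()) (parent-unique yu ya)
            child-of-a-allowed ya (inj₂ (inj₂ (inj₁ (ye , _)))) =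
              root-has-no-parent (subst (_childOf d) (parent-unique ye ya) ed)
            child-of-a-allowed ya (inj₂ (inj₂ (inj₂ (x , yx , _ , d′ , _ , xd′ , _)))) =
              root-has-no-parent (subst (_childOf d′) (parent-unique yx ya) xd′)

            f-allowed : ¬ Excluded f
            f-allowed (inj₁ (fv , _)) = ¬adj-by-height hf hv (λ ()) (λ ()) fv
            f-allowed (inj₂ (inj₁ (fu , _))) = ¬adj-by-height hf hu (λ ()) (λ ()) fu
            f-allowed (inj₂ (inj₂ (inj₁ (_ , f≢f)))) = f≢f refl
            f-allowed (inj₂ (inj₂ (inj₂ (x , fx , _ , d′ , w , xd′ , d′w , _ , w≢v)))) =
              w≢v (parent-unique d′w (subst (_childOf v) d≡d′ dv))
              where
              e≡x = parent-unique fe fx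
              d≡d′ = parent-unique ed (subst (_childOf d′) (sym e≡x) xd′)

            cousin-parent-allowed : ∀ {x d′ w} → x childOf d′ → d′ childOf w → w childOf c → w ≢ v → ¬ Excluded d′
            cousin-parent-allowed xd′ d′w wc w≢v (inj₁ d′v) = w≢v (parent-unique d′w d′v)
            cousin-parent-allowed xd′ d′w wc w≢v (inj₂ (inj₁ d′u)) =
              b≢c (parent-unique ub (subst (_childOf c) (parent-unique d′w d′u) wc))
            cousin-parent-allowed xd′ d′w wc w≢v (inj₂ (inj₂ (inj₁ (d′e , _)))) =
              childOf-asym vc (subst (_childOf v) (sym c≡d) dv)
              where
              c≡d = parent-unique (subst (_childOf c) (parent-unique d′w d′e) wc) ed
            cousin-parent-allowed xd′ d′w wc w≢v (inj₂ (inj₂ (inj₂ (x′ , d′x′ , hx′ , _)))) =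
              root-has-no-parent (subst (_childOf c) (sym a≡w) wc)
              where
              w≡x′ = parent-unique d′w d′x′
              a≡w = unique-height1-neighbour hc (adj-sym ac) (adj-sym (proj₁ wc)) ha (trans (cong height w≡x′) hx′)

            height1-dominated : ∀ {z} → height z ≡ 1 → Σ V λ y → ¬ Excluded y × Adj T z y
            height1-dominated {z} hz with z ≟F a | z ≟F e | Cousin? z
            ... | yes refl | _ | _ = c , child-of-a-allowed c-child , ac
            ... | no _ | yes refl | _ = f , f-allowed , adj-sym (proj₁ fe)
            ... | no _ | no _ | yes (_ , d′ , w , zd′ , d′w , wc , w≢v) =
              d′ , cousin-parent-allowed zd′ d′w wc w≢v , proj₁ zd′
            ... | no z≢a | no z≢e | no ¬cousin with height-step hz
            ...   | y , zy , hy = y , leaf-allowed , zy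
              where
              yz : y childOf z
              yz = leaf-is-child hy (≢-by-height hy ha λ ()) (adj-sym zy)
              leaf-allowed : ¬ Excluded y
              leaf-allowed (inj₁ (yv , _)) = ¬adj-by-height hy hv (λ ()) (λ ()) yv
              leaf-allowed (inj₂ (inj₁ (yu , _))) = ¬adj-by-height hy hu (λ ()) (λ ()) yu
              leaf-allowed (inj₂ (inj₂ (inj₁ (ye , _)))) = z≢e (parent-unique yz ye)
              leaf-allowed (inj₂ (inj₂ (inj₂ (x , yx , cousin)))) = ¬cousin (subst Cousin (sym (parent-unique yz yx)) cousin)

            height3-dominated : ∀ {z} → height z ≡ 3 → Σ V λ y → ¬ Excluded y × Adj T z y
            height3-dominated {z} hz with z ≟F v | z ≟F u
            ... | yes refl | _ = c , child-of-a-allowed c-child , proj₁ vc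
            ... | no _ | yes refl = b , child-of-a-allowed b-child , proj₁ ub
            ... | no z≢v | no z≢u with parent (≢-by-height hz ha λ ())
            ...   | p , zp with another-child zp (height≢ hz λ ())
            ...     | y , yz = y , grandchild-allowed , adj-sym (proj₁ yz)
              where
              grandchild-allowed : ¬ Excluded y
              grandchild-allowed (inj₁ yv) = z≢v (parent-unique yz yv)
              grandchild-allowed (inj₂ (inj₁ yu)) = z≢u (parent-unique yz yu)
              grandchild-allowed (inj₂ (inj₂ (inj₁ (ye , _)))) = ≢-by-height hz he (λ ()) (parent-unique yz ye)
              grandchild-allowed (inj₂ (inj₂ (inj₂ (x , yx , hx , _)))) = ≢-by-height hz hx (λ ()) (parent-unique yz yx)

            allowed-dominates : ∀ z → Σ V λ y → ¬ Excluded y × Adj T z y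
            allowed-dominates z with height-cases z
            ... | inj₁ hz = let y , zy = neighbour z in y , height1-allowed (neighbour-of-height0 hz zy) , zy
            ... | inj₂ (inj₁ hz) = height1-dominated hz
            ... | inj₂ (inj₂ (inj₁ hz)) = let y , zy , hy = height-step hz in y , height1-allowed hy , zy
            ... | inj₂ (inj₂ (inj₂ hz)) = height3-dominated hz

            module InsideAllowed {S} (S-allowed : ∀ {y} → y ∈ S → ¬ Excluded y) (S-TDS : IsTDS T S) where

              Dominated : V → Set
              Dominated z = (Σ V λ y → y ∈ S × y ≢ c × y ≢ f × Adj T z y) ⊎ Adj T z d

              parent-in-S : ∀ {x p} → x childOf p → (∀ {y} → y childOf x → Excluded y) → p ∈ S
              parent-in-S {x} xp children-excluded with S-TDS x
              ... | y , y∈S , xy with adj⇒childOf xy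
              ...   | inj₁ xy′ = subst (_∈ S) (parent-unique xy′ xp) y∈S
              ...   | inj₂ yx = ⊥-elim (S-allowed y∈S (children-excluded yx))

              c∈S : c ∈ S
              c∈S = parent-in-S vc inj₁

              b∈S : b ∈ S
              b∈S = parent-in-S ub (inj₂ ∘ inj₁)

              f∈S : f ∈ S
              f∈S with S-TDS e
              ... | y , y∈S , ey with adj⇒childOf ey | y ≟F f
              ...   | _ | yes refl = y∈S
              ...   | inj₁ ey′ | no _ = ⊥-elim (S-allowed y∈S (inj₁ (subst (_childOf v) (parent-unique ed ey′) dv)))
              ...   | inj₂ ye | no y≢f = ⊥-elim (S-allowed y∈S (inj₂ (inj₂ (inj₁ (ye , y≢f)))))

              grandparent-dominated : ∀ {z} → z childOf c → height z ≡ 3 → z ≢ v → Dominated z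
              grandparent-dominated {z} zc hz z≢v with another-child zc (height≢ hz λ ())
              ... | d′ , d′z with neighbour-of-height3 hz (adj-sym (proj₁ d′z))
              ...   | hd′ with lower-child d′z hd′ (height≢ hz λ ())
              ...     | x , xd′ , hx with S-TDS x
              ...       | y , y∈S , xy with adj⇒childOf xy
              ...         | inj₂ yx =
                ⊥-elim (S-allowed y∈S (inj₂ (inj₂ (inj₂ (x , yx , hx , d′ , z , xd′ , d′z , zc , z≢v)))))
              ...         | inj₁ xy′ = inj₁ (d′ , subst (_∈ S) (parent-unique xy′ xd′) y∈S ,
                                             (λ { refl → childOf-asym zc d′z }) , ≢-by-height hd′ hf (λ ()) , adj-sym (proj₁ d′z))

              neighbour-of-c-dominated : ∀ {z} → Adj T z c → Dominated z
              neighbour-of-c-dominated {z} zc with adj⇒childOf zc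
              ... | inj₂ cz =
                inj₁ (b , b∈S , b≢c , ≢-by-height hb hf (λ ()) , subst (λ q → Adj T q b) (parent-unique c-child cz) ab)
              ... | inj₁ z↑c with adjacent-heights zc | z ≟F v
              ...   | inj₂ hc≡ | _ = ⊥-elim (root-has-no-parent (subst (_childOf c) (sym a≡z) z↑c))
                where
                a≡z = unique-height1-neighbour hc (adj-sym ac) (adj-sym zc) ha (suc-injective (trans (sym hc≡) hc))
              ...   | inj₁ _ | yes refl = inj₂ (adj-sym (proj₁ dv))
              ...   | inj₁ hz≡ | no z≢v = grandparent-dominated z↑c (trans hz≡ (cong suc hc)) z≢v

              dominated : ∀ z → Dominated z
              dominated z with z ≟F e | S-TDS z
              ... | yes refl | _ = inj₂ (proj₁ ed)
              ... | no z≢e | y , y∈S , zy with y ≟F c | y ≟F f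
              ...   | no y≢c | no y≢f = inj₁ (y , y∈S , y≢c , y≢f , zy)
              ...   | _ | yes refl = ⊥-elim (z≢e (leaf-neighbour-unique T (height≡0⇒leaf hf) (adj-sym zy) (proj₁ fe)))
              ...   | yes refl | no _ = neighbour-of-c-dominated zy

            swap : ∀ {S} → (∀ {y} → y ∈ S → ¬ Excluded y) → IsTDS T S → TwoForOne S
            swap S-allowed S-TDS = record
              { x = c ; y = f ; z = d
              ; x∈S = c∈S ; y∈S = f∈S ; x≢y = ≢-by-height hc hf λ ()
              ; dominated = dominated
              }
              where open InsideAllowed S-allowed S-TDS

            impossible : ⊥
            impossible = wtd⇒¬TwoForOne-within wtd (¬? ∘ Excluded?) allowed-dominates swap

          impossible : ⊥
          impossible with height3-child hb b-child | height3-child hc c-child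
          ... | u , ub , hu | v , vc , hv with another-child vc (height≢ hv λ ())
          ... | d , dv with neighbour-of-height3 hv (adj-sym (proj₁ dv))
          ... | hd with lower-child dv hd (height≢ hv λ ())
          ... | e , ed , he with lower-child ed he (height≢ hd λ ())
          ... | f , fe , hf = Configuration.impossible ub hu vc hv dv hd ed he fe hf

      unique-height2-neighbour : ∀ {a b c} → height a ≡ 1 → Adj T a b → Adj T a c →
                                 height b ≡ 2 → height c ≡ 2 → b ≡ c
      unique-height2-neighbour {b = b} {c} ha ab ac hb hc with b ≟F c
      ... | yes b≡c = b≡c
      ... | no b≢c = ⊥-elim (TwoHeight2Neighbours.impossible ha ab ac hb hc b≢c)

    -- Exhausting T by O-operations

    module Exhaustion (wtd : WellTotallyDominated T) where

      open RootedAt v₀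

      -- The shape of the path that O attaches at anchor.
      record HangingPath (m : ℕ) (anchor : V) : Set where
        field
          vertex : Fin (suc m) → V
          height-vertex : ∀ j → height (vertex j) ≡ toℕ j
          link : ∀ (j : Fin m) → vertex (inject₁ j) childOf vertex (suc j)
          top : vertex (fromℕ m) childOf anchor

        vertex-injective : ∀ {i j} → vertex i ≡ vertex j → i ≡ j
        vertex-injective {i} {j} eq = toℕ-injective (trans (sym (height-vertex i)) (trans (cong height eq) (height-vertex j)))

        parent-on-path : ∀ j → (toℕ j ≡ m × vertex j childOf anchor) ⊎
                               Σ (Fin (suc m)) λ j′ → vertex j childOf vertex j′
        parent-on-path j with lastView j
        ... | last = inj₁ (toℕ-fromℕ m , top)
        ... | inner i = inj₂ (suc i , link i)

      open HangingPath

      extend : ∀ {m w a} → HangingPath m w → w childOf a → height w ≡ suc m → HangingPath (suc m) a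
      extend {m} {w} {a} path wa hw = record
        { vertex = vertex path ▷ w
        ; height-vertex = heights
        ; link = links
        ; top = subst (_childOf a) (sym (▷-fromℕ (vertex path) w)) wa
        }
        where
        heights : ∀ j → height ((vertex path ▷ w) j) ≡ toℕ j
        heights j with lastView j
        ... | last = trans (cong height (▷-fromℕ (vertex path) w)) (trans hw (sym (cong suc (toℕ-fromℕ m))))
        ... | inner i = trans (cong height (▷-inject₁ (vertex path) w i)) (trans (height-vertex path i) (sym (toℕ-inject₁ i)))
        links : ∀ j → (vertex path ▷ w) (inject₁ j) childOf (vertex path ▷ w) (suc j)
        links j with lastView j
        ... | last =
          subst₂ _childOf_ (sym (▷-inject₁ (vertex path) w (fromℕ m))) (sym (▷-fromℕ (vertex path) w)) (top path)
        ... | inner i =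
          subst₂ _childOf_ (sym (▷-inject₁ (vertex path) w (inject₁ i))) (sym (▷-inject₁ (vertex path) w (suc i))) (link path i)

      descend : ∀ n {w a} → w childOf a → height w ≡ n → height a ≡ suc n → HangingPath n a
      descend zero {w} wa hw ha = record { vertex = λ _ → w ; height-vertex = λ { zero → hw } ; link = λ () ; top = wa }
      descend (suc n) wa hw ha with lower-child wa hw (height≢ ha λ eq → <-irrefl (sym eq) (m<n⇒m<1+n (n<1+n n)))
      ... | c , cw , hc = extend (descend n cw hc hw) wa hw

      height3-path : ∀ {t a} → t childOf a → height t ≡ 3 → HangingPath 3 a
      height3-path t↑a ht with another-child t↑a (height≢ ht λ ())
      ... | d , d↑t = extend (descend 2 d↑t (neighbour-of-height3 ht (adj-sym (proj₁ d↑t))) ht) t↑a ht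

      restrict : ∀ {m a} (path : HangingPath (suc m) a) → HangingPath m (vertex path (fromℕ (suc m)))
      restrict {m} path = record
        { vertex = vertex path ∘ inject₁
        ; height-vertex = λ j → trans (height-vertex path (inject₁ j)) (toℕ-inject₁ j)
        ; link = λ j → link path (inject₁ j)
        ; top = link path (fromℕ m)
        }

      reaches-top : ∀ {m a} (path : HangingPath m a) {Q : V → Set} → (∀ {u p} → u childOf p → Q u → Q p) →
                    ∀ j → Q (vertex path j) → Q (vertex path (fromℕ m))
      reaches-top {zero} path Q-up zero q = q
      reaches-top {suc m} path Q-up j q with lastView j
      ... | last = q
      ... | inner i = Q-up (link path (fromℕ m)) (reaches-top (restrict path) Q-up i q)

      Image : ∀ {I : Set} → (I → V) → V → Set
      Image {I} E t = Σ I λ x → E x ≡ t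

      -- What the image must contain around E x for heights in the copy to agree with heights in T.
      record Witnessed {I : Set} (E : I → V) (x : I) : Set where
        field
          descent : ∀ {k} → height (E x) ≡ suc k → Σ I λ y → Adj T (E x) (E y) × height (E y) ≡ k
          branching : height (E x) ≢ 0 → Σ I λ y → Σ I λ y′ → y ≢ y′ × Adj T (E x) (E y) × Adj T (E x) (E y′)

      witnessed-map : ∀ {I J : Set} {E : I → V} {E′ : J → V} (f : I → J) → (∀ {x y} → f x ≡ f y → x ≡ y) →
                      (∀ x → E′ (f x) ≡ E x) → ∀ {x} → Witnessed E x → Witnessed E′ (f x)
      witnessed-map {E = E} {E′} f f-injective E′∘f≡E {x} w = record
        { descent = λ hx → let y , xy , hy = descent (trans (cong height (sym (E′∘f≡E x))) hx) in
            f y , move xy , trans (cong height (E′∘f≡E y)) hy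
        ; branching = λ hx≢0 → let y , y′ , y≢y′ , xy , xy′ = branching (hx≢0 ∘ trans (cong height (E′∘f≡E x))) in
            f y , f y′ , y≢y′ ∘ f-injective , move xy , move xy′
        }
        where
        open Witnessed w
        move : ∀ {y} → Adj T (E x) (E y) → Adj T (E′ (f x)) (E′ (f y))
        move = subst₂ (Adj T) (sym (E′∘f≡E x)) (sym (E′∘f≡E _))

      record Embedding : Set where
        field
          H : Graph
          k : ℕ
          built : OSeq (P 6) k H
          e : Vertex H → V
          e-adj : ∀ x y → adj H x y ≡ adj T (e x) (e y)
          e-injective : ∀ {x y} → e x ≡ e y → x ≡ y
          parent-closed : ∀ x {p} → e x childOf p → Image e p
          root-in-image : Image e v₀
          witnessed : ∀ x → Witnessed e x

        e-preserves-adj : ∀ {x y} → Adj H x y → Adj T (e x) (e y)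
        e-preserves-adj {x} {y} xy = trans (sym (e-adj x y)) xy

        e-reflects-adj : ∀ {x y} → Adj T (e x) (e y) → Adj H x y
        e-reflects-adj {x} {y} xy = trans (e-adj x y) xy

        Height-e : ∀ x → Height H x (height (e x))
        Height-e = labelling-height H (height ∘ e) height≡0⇒leaf′ leaf⇒height≡0′ descends (height-adj ∘ e-preserves-adj)
          where
          height≡0⇒leaf′ : ∀ {x} → height (e x) ≡ 0 → IsLeaf H x
          height≡0⇒leaf′ {x} hx with parent (≢-by-height hx height-v₀ λ ())
          ... | p , xp with parent-closed x xp
          ...   | y , refl = unique-neighbour⇒leaf H (e-reflects-adj (proj₁ xp))
                  λ xz → e-injective (leaf-neighbour-unique T (height≡0⇒leaf hx) (e-preserves-adj xz) (proj₁ xp))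
          leaf⇒height≡0′ : ∀ {x} → IsLeaf H x → height (e x) ≡ 0
          leaf⇒height≡0′ {x} leaf with height (e x) ≟ 0
          ... | yes hx = hx
          ... | no hx≢0 = let y , y′ , y≢y′ , xy , xy′ = Witnessed.branching (witnessed x) hx≢0 in
                          ⊥-elim (y≢y′ (leaf-neighbour-unique H leaf (e-reflects-adj xy) (e-reflects-adj xy′)))
          descends : ∀ {x k} → height (e x) ≡ suc k → Σ (Vertex H) λ y → Adj H x y × height (e y) ≡ k
          descends {x} hx = let y , xy , hy = Witnessed.descent (witnessed x) hx in y , e-reflects-adj xy , hy

      module Attach (s : Embedding) {x h} (valid : ValidHeight h) (hx : height (Embedding.e s x) ≡ h)
                    (path : HangingPath (attachedPath h) (Embedding.e s x))
                    (fresh : ¬ Image (Embedding.e s) (vertex path (fromℕ (attachedPath h)))) where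

        open Embedding s

        m : ℕ
        m = attachedPath h

        g : Fin (suc m) → V
        g = vertex path

        E : Vertex H ⊎ Fin (suc m) → V
        E = [ e , g ]

        path-outside-image : ∀ a j → e a ≢ g j
        path-outside-image a j ea≡gj = fresh (reaches-top path image-upward j (a , ea≡gj))
          where
          image-upward : ∀ {u p} → u childOf p → Image e u → Image e p
          image-upward up (y , refl) = parent-closed y up

        E-injective : ∀ {p q} → E p ≡ E q → p ≡ q
        E-injective {inj₁ a} {inj₁ b} eq = cong inj₁ (e-injective eq)
        E-injective {inj₁ a} {inj₂ j} eq = ⊥-elim (path-outside-image a j eq)
        E-injective {inj₂ i} {inj₁ b} eq = ⊥-elim (path-outside-image b i (sym eq))
        E-injective {inj₂ i} {inj₂ j} eq = cong inj₂ (vertex-injective path eq)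

        cross-edge : ∀ {a j} → Adj T (e a) (g j) ⇔ (a ≡ x × toℕ j ≡ m)
        cross-edge {a} {j} = mk⇔ to from
          where
          to : Adj T (e a) (g j) → a ≡ x × toℕ j ≡ m
          to aj with adj⇒childOf aj
          ... | inj₁ a↑j = ⊥-elim (let y , ey≡gj = parent-closed a a↑j in path-outside-image y j ey≡gj)
          ... | inj₂ j↑a with parent-on-path path j
          ...   | inj₁ (j≡m , j↑x) = e-injective (parent-unique j↑a j↑x) , j≡m
          ...   | inj₂ (j′ , j↑j′) = ⊥-elim (path-outside-image a j′ (parent-unique j↑a j↑j′))
          from : a ≡ x × toℕ j ≡ m → Adj T (e a) (g j)
          from (refl , j≡m) =
            subst (λ i → Adj T (e a) (g i)) (toℕ-injective (trans (toℕ-fromℕ m) (sym j≡m))) (adj-sym (proj₁ (top path)))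

        path-edges⇔Consecutive : ∀ {i j} → Adj T (g i) (g j) ⇔ Consecutive i j
        path-edges⇔Consecutive {i} {j} =
          mk⇔ to (steps⇒Consecutive (λ {u} {w} → adj-sym {u} {w}) g (λ k → proj₁ (link path k)))
          where
          to : Adj T (g i) (g j) → Consecutive i j
          to ij with adjacent-heights ij
          ... | inj₁ hi≡ = inj₂ (sym (trans (sym (height-vertex path i)) (trans hi≡ (cong suc (height-vertex path j)))))
          ... | inj₂ hj≡ = inj₁ (sym (trans (sym (height-vertex path j)) (trans hj≡ (cong suc (height-vertex path i)))))

        attachAdj⇔cross : ∀ {a} {j : Fin (suc m)} → (isYes (a ≟F x) ∧ (toℕ j ≡ᵇ m)) ≡ true ⇔ (a ≡ x × toℕ j ≡ m)
        attachAdj⇔cross = ⇔-trans (⇔-sym T-≡)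
          (⇔-trans T-∧ (mk⇔ (Product.map toWitness (≡ᵇ⇒≡ _ _)) (Product.map fromWitness (≡⇒≡ᵇ _ _))))

        E-adj : ∀ p q → attachAdj H x m p q ≡ adj T (E p) (E q)
        E-adj (inj₁ a) (inj₁ b) = e-adj a b
        E-adj (inj₁ a) (inj₂ j) = ⇔→≡ (⇔-trans attachAdj⇔cross (⇔-sym cross-edge))
        E-adj (inj₂ i) (inj₁ b) = trans (E-adj (inj₁ b) (inj₂ i)) (proj₁ simple (e b) (g i))
        E-adj (inj₂ i) (inj₂ j) = path-embedding T g path-edges⇔Consecutive i j

        E-parent-closed : ∀ p {t} → E p childOf t → Image E t
        E-parent-closed (inj₁ a) a↑t = let y , ey≡t = parent-closed a a↑t in inj₁ y , ey≡t
        E-parent-closed (inj₂ j) j↑t with parent-on-path path j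
        ... | inj₁ (_ , j↑x) = inj₁ x , parent-unique j↑x j↑t
        ... | inj₂ (j′ , j↑j′) = inj₂ j′ , parent-unique j↑j′ j↑t

        path-witnessed : ∀ j → Witnessed E (inj₂ j)
        path-witnessed zero = record
          { descent = λ h0≡ → contradiction (trans (sym (height-vertex path zero)) h0≡) λ ()
          ; branching = λ h0≢0 → contradiction (height-vertex path zero) h0≢0
          }
        path-witnessed (suc i) = record
          { descent = λ hj≡ →
              inj₂ (inject₁ i) , child-adj , suc-injective (trans child-height (trans (sym (height-vertex path (suc i))) hj≡))
          ; branching = λ _ → branches (parent-on-path path (suc i))
          }
          where
          child-adj : Adj T (g (suc i)) (g (inject₁ i))
          child-adj = adj-sym (proj₁ (link path i))
          child-height : suc (height (g (inject₁ i))) ≡ suc (toℕ i)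
          child-height = cong suc (trans (height-vertex path (inject₁ i)) (toℕ-inject₁ i))
          branches : (toℕ (suc i) ≡ m × g (suc i) childOf e x) ⊎ Σ (Fin (suc m)) (λ j′ → g (suc i) childOf g j′) →
                     Σ _ λ y → Σ _ λ y′ → y ≢ y′ × Adj T (g (suc i)) (E y) × Adj T (g (suc i)) (E y′)
          branches (inj₁ (_ , i↑x)) = inj₂ (inject₁ i) , inj₁ x , (λ ()) , child-adj , proj₁ i↑x
          branches (inj₂ (j′ , i↑j′)) =
            inj₂ (inject₁ i) , inj₂ j′ , (λ { refl → childOf-asym (link path i) i↑j′ }) , child-adj , proj₁ i↑j′

        E-witnessed : ∀ p → Witnessed E p
        E-witnessed (inj₁ a) = witnessed-map inj₁ (λ { refl → refl }) (λ _ → refl) (witnessed a)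
        E-witnessed (inj₂ j) = path-witnessed j

        grown : Embedding
        grown = record
          { H = O H x h
          ; k = suc k
          ; built = step built x h valid (subst (Height H x) hx (Height-e x))
          ; e = E ∘ splitAt (size H)
          ; e-adj = λ p q → E-adj (splitAt (size H) p) (splitAt (size H) q)
          ; e-injective = splitAt-injective (size H) ∘ E-injective
          ; parent-closed = λ p p↑t → let q , Eq≡t = E-parent-closed (splitAt (size H) p) p↑t in
              join (size H) (suc m) q , trans (cong E (splitAt-join (size H) (suc m) q)) Eq≡t
          ; root-in-image = let y , ey≡v₀ = root-in-image in
              y ↑ˡ suc m , trans (cong E (splitAt-↑ˡ (size H) y (suc m))) ey≡v₀
          ; witnessed = λ p → subst (Witnessed (E ∘ splitAt (size H))) (join-splitAt (size H) (suc m) p)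
              (witnessed-map (join (size H) (suc m)) (join-injective (size H) (suc m))
                             (cong E ∘ splitAt-join (size H) (suc m)) (E-witnessed (splitAt (size H) p)))
          }

        grown-larger : size H < size (Embedding.H grown)
        grown-larger = subst (size H <_) (sym (+-suc (size H) m)) (s≤s (m≤m+n (size H) m))

      module Growth (s : Embedding) where

        open Embedding s

        Larger : Set
        Larger = Σ Embedding λ s′ → size H < size (Embedding.H s′)

        attach-path : ∀ {x h} → ValidHeight h → height (e x) ≡ h → (path : HangingPath (attachedPath h) (e x)) →
                 ¬ Image e (vertex path (fromℕ (attachedPath h))) → Larger
        attach-path valid hx path fresh = Attach.grown s valid hx path fresh , Attach.grown-larger s valid hx path fresh

        no-child-of-leaf : ∀ {t y} → ¬ Image e t → t childOf e y → height (e y) ≢ 0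
        no-child-of-leaf {t} {y} t∉ t↑y hy with parent (≢-by-height hy height-v₀ λ ())
        ... | p , y↑p = t∉ (subst (Image e) (sym t≡p) (parent-closed y y↑p))
          where
          t≡p = leaf-neighbour-unique T (height≡0⇒leaf hy) (adj-sym (proj₁ t↑y)) (proj₁ y↑p)

        no-height2-child-of-height1 : ∀ {t y} → ¬ Image e t → t childOf e y → height (e y) ≡ 1 → height t ≢ 2
        no-height2-child-of-height1 {t} {y} t∉ t↑y hy ht with parent (≢-by-height hy height-v₀ λ ())
        ... | p , y↑p with adjacent-heights (proj₁ y↑p)
        ...   | inj₁ hy≡ = childOf-asym y↑p (leaf-is-child hp (≢-by-height hp height-v₀ λ ()) (adj-sym (proj₁ y↑p)))
          where
          hp = suc-injective (trans (sym hy≡) hy)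
        ...   | inj₂ hp≡ = t∉ (subst (Image e) (sym t≡p) (parent-closed y y↑p))
          where
          t≡p = unique-height2-neighbour wtd hy (adj-sym (proj₁ t↑y)) (proj₁ y↑p) ht (trans hp≡ (cong suc hy))

        no-height1-child-of-height2 : ∀ {t y} → ¬ Image e t → t childOf e y → height (e y) ≡ 2 → height t ≢ 1
        no-height1-child-of-height2 {t} {y} t∉ t↑y hy ht with Witnessed.descent (witnessed y) hy
        ... | z , yz , hz = t∉ (z , sym (unique-height1-neighbour wtd hy (adj-sym (proj₁ t↑y)) yz ht hz))

        -- The heights of t and of its parent differ by one: the pairs (0,1), (2,3) and (3,2) are the
        -- three O-operations, and in the pairs (1,0), (2,1) and (1,2) the vertex t is already in the image.
        grow : ∀ {t y} → ¬ Image e t → t childOf e y → Larger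
        grow {t} {y} t∉ t↑y with adjacent-heights (proj₁ t↑y)
        ... | inj₁ ht≡ with height-cases (e y)
        ...   | inj₁ hy = ⊥-elim (no-child-of-leaf t∉ t↑y hy)
        ...   | inj₂ (inj₁ hy) = ⊥-elim (no-height2-child-of-height1 t∉ t↑y hy (trans ht≡ (cong suc hy)))
        ...   | inj₂ (inj₂ (inj₁ hy)) = attach-path (inj₂ (inj₁ refl)) hy (height3-path t↑y (trans ht≡ (cong suc hy))) t∉
        ...   | inj₂ (inj₂ (inj₂ hy)) = ⊥-elim (height≢4 (trans ht≡ (cong suc hy)))
        grow {t} {y} t∉ t↑y | inj₂ hy≡ with height-cases t
        ...   | inj₁ ht = attach-path (inj₁ refl) hy (descend 0 t↑y ht hy) t∉
          where hy = trans hy≡ (cong suc ht)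
        ...   | inj₂ (inj₁ ht) = ⊥-elim (no-height1-child-of-height2 t∉ t↑y (trans hy≡ (cong suc ht)) ht)
        ...   | inj₂ (inj₂ (inj₁ ht)) = attach-path (inj₂ (inj₂ refl)) hy (descend 2 t↑y ht hy) t∉
          where hy = trans hy≡ (cong suc ht)
        ...   | inj₂ (inj₂ (inj₂ ht)) = ⊥-elim (height≢4 (trans hy≡ (cong suc ht)))

        frontier : ∀ {t} → ¬ Image e t → Σ V λ t′ → ¬ Image e t′ × Σ (Vertex H) λ y → t′ childOf e y
        frontier {t} = climb (suc (depth t)) ≤-refl
          where
          climb : ∀ fuel {t} → depth t < fuel → ¬ Image e t →
                  Σ V λ t′ → ¬ Image e t′ × Σ (Vertex H) λ y → t′ childOf e y
          climb (suc fuel) {t} dt<fuel t∉ with parent (λ { refl → t∉ root-in-image })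
          ... | p , t↑p with any? (λ y → e y ≟F p)
          ...   | yes (y , refl) = t , t∉ , y , t↑p
          ...   | no p∉ = climb fuel (subst (_≤ fuel) (proj₂ t↑p) (≤-pred dt<fuel)) p∉

        outside⇒size< : ∀ {t} → ¬ Image e t → size H < size T
        outside⇒size< {t} t∉ = injective⇒≤ {f = t ∷ᶠ e} injective
          where
          injective : ∀ {p q} → (t ∷ᶠ e) p ≡ (t ∷ᶠ e) q → p ≡ q
          injective {zero} {zero} _ = refl
          injective {zero} {suc q} t≡eq = ⊥-elim (t∉ (q , sym t≡eq))
          injective {suc p} {zero} ep≡t = ⊥-elim (t∉ (p , ep≡t))
          injective {suc p} {suc q} ep≡eq = cong suc (e-injective ep≡eq)

        onto⇒≅ : (∀ t → Image e t) → T ≅ H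
        onto⇒≅ onto = mk↔ₛ′ e⁻¹ e (λ x → e-injective (proj₂ (onto (e x)))) (λ t → proj₂ (onto t)) ,
                      λ u v → trans (e-adj (e⁻¹ u) (e⁻¹ v)) (cong₂ (adj T) (proj₂ (onto u)) (proj₂ (onto v)))
          where
          e⁻¹ : V → Vertex H
          e⁻¹ t = proj₁ (onto t)

      exhaust : ∀ fuel (s : Embedding) → size T ≤ size (Embedding.H s) + fuel →
                Σ Embedding λ s′ → ∀ t → Image (Embedding.e s′) t
      exhaust fuel s size≤ with all? (λ t → any? (λ x → Embedding.e s x ≟F t))
      ... | yes onto = s , onto
      ... | no ¬onto with ¬∀⟶∃¬ _ _ (λ t → any? (λ x → Embedding.e s x ≟F t)) ¬onto
      ...   | t , t∉ with fuel
      ...     | zero = ⊥-elim (<⇒≱ (Growth.outside⇒size< s t∉) (subst (size T ≤_) (+-identityʳ _) size≤))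
      ...     | suc fuel′ with Growth.frontier s t∉
      ...       | t′ , t′∉ , y , t′↑y with Growth.grow s t′∉ t′↑y
      ...         | s′ , larger =
        exhaust fuel′ s′ (≤-trans size≤ (subst (_≤ size (Embedding.H s′) + fuel′) (sym (+-suc _ fuel′)) (+-monoˡ-≤ fuel′ larger)))

      module InitialPath {b c} (b≢c : b ≢ c) (v₀b : Adj T v₀ b) (v₀c : Adj T v₀ c) where

        left right : HangingPath 2 v₀
        left = descend 2 (root-neighbour-is-child v₀b) (neighbour-of-height3 height-v₀ v₀b) height-v₀
        right = descend 2 (root-neighbour-is-child v₀c) (neighbour-of-height3 height-v₀ v₀c) height-v₀

        p₆ : Fin 7 → V
        p₆ 0F = vertex left 0F
        p₆ 1F = vertex left 1F
        p₆ 2F = vertex left 2F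
        p₆ 3F = v₀
        p₆ 4F = vertex right 2F
        p₆ 5F = vertex right 1F
        p₆ 6F = vertex right 0F

        p₆-height : ∀ i → height (p₆ i) ≡ P₆-height i
        p₆-height 0F = height-vertex left 0F
        p₆-height 1F = height-vertex left 1F
        p₆-height 2F = height-vertex left 2F
        p₆-height 3F = height-v₀
        p₆-height 4F = height-vertex right 2F
        p₆-height 5F = height-vertex right 1F
        p₆-height 6F = height-vertex right 0F

        meet-above : ∀ (k : Fin 2) → vertex left (inject₁ k) ≡ vertex right (inject₁ k) →
                     vertex left (suc k) ≡ vertex right (suc k)
        meet-above k eq = parent-unique (link left k) (subst (_childOf _) (sym eq) (link right k))

        arms-disjoint : ∀ j → vertex left j ≢ vertex right j
        arms-disjoint 0F = b≢c ∘ meet-above 1F ∘ meet-above 0F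
        arms-disjoint 1F = b≢c ∘ meet-above 1F
        arms-disjoint 2F = b≢c

        p₆-mirror : ∀ i → p₆ i ≡ p₆ (opposite i) → i ≡ opposite i
        p₆-mirror 0F eq = ⊥-elim (arms-disjoint 0F eq)
        p₆-mirror 1F eq = ⊥-elim (arms-disjoint 1F eq)
        p₆-mirror 2F eq = ⊥-elim (arms-disjoint 2F eq)
        p₆-mirror 3F _ = refl
        p₆-mirror 4F eq = ⊥-elim (arms-disjoint 2F (sym eq))
        p₆-mirror 5F eq = ⊥-elim (arms-disjoint 1F (sym eq))
        p₆-mirror 6F eq = ⊥-elim (arms-disjoint 0F (sym eq))

        p₆-injective : ∀ {i j} → p₆ i ≡ p₆ j → i ≡ j
        p₆-injective {i} {j} eq with P₆-height-mirror i j (trans (sym (p₆-height i)) (trans (cong height eq) (p₆-height j)))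
        ... | inj₁ i≡j = i≡j
        ... | inj₂ refl = p₆-mirror i eq

        p₆-parent : ∀ i {t} → p₆ i childOf t → Σ (Fin 7) λ j → p₆ j ≡ t × Consecutive i j
        p₆-parent 0F i↑t = 1F , parent-unique (link left 0F) i↑t , inj₁ refl
        p₆-parent 1F i↑t = 2F , parent-unique (link left 1F) i↑t , inj₁ refl
        p₆-parent 2F i↑t = 3F , parent-unique (top left) i↑t , inj₁ refl
        p₆-parent 3F i↑t = ⊥-elim (root-has-no-parent i↑t)
        p₆-parent 4F i↑t = 3F , parent-unique (top right) i↑t , inj₂ refl
        p₆-parent 5F i↑t = 4F , parent-unique (link right 1F) i↑t , inj₂ refl
        p₆-parent 6F i↑t = 5F , parent-unique (link right 0F) i↑t , inj₂ refl

        p₆-edge : ∀ (k : Fin 6) → Adj T (p₆ (inject₁ k)) (p₆ (suc k))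
        p₆-edge 0F = proj₁ (link left 0F)
        p₆-edge 1F = proj₁ (link left 1F)
        p₆-edge 2F = proj₁ (top left)
        p₆-edge 3F = adj-sym (proj₁ (top right))
        p₆-edge 4F = adj-sym (proj₁ (link right 1F))
        p₆-edge 5F = adj-sym (proj₁ (link right 0F))

        p₆-edges⇔Consecutive : ∀ {i j} → Adj T (p₆ i) (p₆ j) ⇔ Consecutive i j
        p₆-edges⇔Consecutive {i} {j} = mk⇔ to (steps⇒Consecutive (λ {u} {w} → adj-sym {u} {w}) p₆ p₆-edge)
          where
          via-parent : ∀ {i j} → p₆ i childOf p₆ j → Consecutive i j
          via-parent {i} i↑j with p₆-parent i i↑j
          ... | j′ , eq , i~j′ = subst (Consecutive i) (p₆-injective eq) i~j′
          to : Adj T (p₆ i) (p₆ j) → Consecutive i j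
          to ij with adj⇒childOf ij
          ... | inj₁ i↑j = via-parent i↑j
          ... | inj₂ j↑i = Sum.swap (via-parent j↑i)

        p₆-witnessed : ∀ i → Witnessed p₆ i
        p₆-witnessed i = record
          { descent = λ hi≡ → let j , i~j , hj≡ = P₆-height-descends i (λ h≡0 → 1+n≢0 (trans (sym (label hi≡)) h≡0)) in
              j , Equivalence.from p₆-edges⇔Consecutive i~j , suc-injective (trans (cong suc (p₆-height j)) (trans hj≡ (label hi≡)))
          ; branching = λ hi≢0 → let j , j′ , j≢j′ , i~j , i~j′ = P₆-inner-branches i (hi≢0 ∘ trans (p₆-height i)) in
              j , j′ , j≢j′ , Equivalence.from p₆-edges⇔Consecutive i~j , Equivalence.from p₆-edges⇔Consecutive i~j′
          }
          where
          label : ∀ {h} → height (p₆ i) ≡ h → P₆-height i ≡ h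
          label = trans (sym (p₆-height i))

        embedding : Embedding
        embedding = record
          { H = P 6
          ; k = 0
          ; built = done
          ; e = p₆
          ; e-adj = path-embedding T p₆ p₆-edges⇔Consecutive
          ; e-injective = p₆-injective
          ; parent-closed = λ i i↑t → let j , eq , _ = p₆-parent i i↑t in j , eq
          ; root-in-image = 3F , refl
          ; witnessed = p₆-witnessed
          }

      initial : Embedding
      initial with neighbour v₀
      ... | b , v₀b with another-neighbour-of-inner (height≢ height-v₀ λ ()) v₀b
      ... | c , v₀c , c≢b = InitialPath.embedding (c≢b ∘ sym) v₀b v₀c

      T≅O-sequence : Σ ℕ λ k → Σ Graph λ H → OSeq (P 6) k H × (T ≅ H)
      T≅O-sequence with exhaust (size T) initial (m≤n+m (size T) 7)
      ... | s , onto = Embedding.k s , Embedding.H s , Embedding.built s , Growth.onto⇒≅ s onto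

O-sequence-or-P₆ : ∀ {G} → (Σ ℕ λ k → Σ Graph λ H → OSeq (P 6) k H × (G ≅ H)) →
                   (G ≅ P 6) ⊎ (Σ ℕ λ k → (1 ≤ k) × Σ Graph λ H → OSeq (P 6) k H × (G ≅ H))
O-sequence-or-P₆ (_ , _ , done , G≅P₆) = inj₁ G≅P₆
O-sequence-or-P₆ (suc k , H , built , G≅H) = inj₂ (suc k , s≤s z≤n , H , built , G≅H)

theorem6p7 : (T : Graph) → IsTree T → Balanced T → TreeHeight T 3 →
    WellTotallyDominated T →
    (T ≅ P 6) ⊎ (Σ ℕ λ k → (1 ≤ k) × Σ Graph λ H → OSeq (P 6) k H × (T ≅ H))
theorem6p7 T (simple , _ , connected , acyclic) balanced ((v₀ , v₀-Height) , Height≤3) wtd =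
  O-sequence-or-P₆ (Exhaustion.T≅O-sequence wtd)
  where
  open Tree T simple connected acyclic
  open Height3 balanced v₀ v₀-Height Height≤3
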